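{- For all $m\ge 1$ and $n\ge 3$, the tadpole graph $T_{m,n}$ is $Q$-unique: if $H$ is a finite simple graph with $Q(H;x,y)=Q(T_{m,n};x,y)$, then $H\cong T_{m,n}$.
   Context: For a finite simple graph $G=(V,E)$, the subgraph component polynomial is $Q(G;x,y)=\sum_{X\subseteq V} x^{|X|}y^{k(G[X])}$, where $G[X]$ is the induced subgraph on $X$ and $k(\cdot)$ denotes the number of connected components. The $(m,n)$-tadpole graph $T_{m,n}$ is obtained from a path $P_m$ (on $m$ vertices) and a cycle $C_n$ (on $n$ vertices), vertex-disjoint, by adding one edge (a bridge) joining an end vertex of the path to a vertex of the cycle; it has $m+n$ vertices and $m+n$ edges. -}

module Defs where

open import Data.Nat using (ℕ; zero; suc; _+_; _∸_; _≡ᵇ_; _<ᵇ_; _≤ᵇ_)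
open import Data.Bool using (Bool; true; false; _∧_; _∨_; not; if_then_else_)
open import Data.Fin using (Fin; toℕ; _<?_)
open import Data.Fin.Subset using (Subset; ∣_∣; inside; outside)
open import Data.Vec using (Vec; []; _∷_; lookup)
open import Data.List using (List; []; _∷_; map; _++_)
open import Data.List.Base using (allFin)
import Data.List as L
open import Data.Bool.ListAction using (any)
open import Relation.Nullary.Decidable using (does)
open import Relation.Binary.PropositionalEquality using (_≡_; refl; cong; cong₂)
open import Data.Bool.Properties using (∨-comm)

record Graph (N : ℕ) : Set where
  field
    adj    : Fin N → Fin N → Bool
    sym    : ∀ u v → adj u v ≡ adj v u
    irrefl : ∀ u → adj u u ≡ false
open Graph public

record _≅_ {M N : ℕ} (G : Graph M) (H : Graph N) : Set where
  field
    to      : Fin M → Fin N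
    from    : Fin N → Fin M
    to∘from : ∀ v → to (from v) ≡ v
    from∘to : ∀ u → from (to u) ≡ u
    adj-pres : ∀ u v → adj H (to u) (to v) ≡ adj G u v
open _≅_ public

count : {A : Set} → (A → Bool) → List A → ℕ
count p []       = 0
count p (x ∷ xs) = if p x then suc (count p xs) else count p xs

walk : ∀ {N} → Graph N → Subset N → ℕ → Fin N → Fin N → Bool
walk {N} G X zero    u v = does (Data.Fin._≟_ u v) ∧ lookup X u
  where import Data.Fin
walk {N} G X (suc t) u v =
  walk G X t u v ∨
  any (λ w → walk G X t u w ∧ lookup X v ∧ adj G w v) (allFin N)

-- u and v lie in the same component of G[X]
-- (a walk of length ≤ N suffices since G[X] has at most N vertices).
connected : ∀ {N} → Graph N → Subset N → Fin N → Fin N → Bool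
connected {N} G X u v = walk G X N u v

-- k(G[X]): number of connected components of G[X], counted via their
-- least vertex: v ∈ X is the representative of its component iff no
-- smaller vertex of X is connected to v in G[X].
isRep : ∀ {N} → Graph N → Subset N → Fin N → Bool
isRep {N} G X v =
  lookup X v ∧ not (any (λ u → does (u <? v) ∧ connected G X u v) (allFin N))

components : ∀ {N} → Graph N → Subset N → ℕ
components {N} G X = count (isRep G X) (allFin N)

-- The subgraph component polynomial Q(G;x,y) = Σ_X x^|X| y^k(G[X]),
-- represented by its coefficients: Qcoeff G i j is the coefficient of
-- x^i y^j, i.e. the number of X ⊆ V with |X| = i and k(G[X]) = j.

allSubsets : (n : ℕ) → List (Subset n)
allSubsets zero    = [] ∷ []
allSubsets (suc n) = map (outside ∷_) (allSubsets n) ++ map (inside ∷_) (allSubsets n)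

Qcoeff : ∀ {N} → Graph N → ℕ → ℕ → ℕ
Qcoeff {N} G i j =
  count (λ X → (∣ X ∣ ≡ᵇ i) ∧ (components G X ≡ᵇ j)) (allSubsets N)

_≡Q_ : ∀ {M N} → Graph M → Graph N → Set
G ≡Q H = ∀ i j → Qcoeff G i j ≡ Qcoeff H i j

-- Tadpole graph T_{m,n} on vertices 0,…,m+n-1:
--   path P_m       : 0 — 1 — … — (m-1)
--   cycle C_n      : m — (m+1) — … — (m+n-1) — m
--   bridge         : (m-1) — m
-- tadEdge m n a b is the oriented edge test for a < b.

tadEdge : ℕ → ℕ → ℕ → ℕ → Bool
tadEdge m n a b =
     ((b ≡ᵇ suc a) ∧ (b <ᵇ m))
  ∨  ((a ≡ᵇ m ∸ 1) ∧ (b ≡ᵇ m))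
  ∨  ((m ≤ᵇ a) ∧ (b <ᵇ m + n) ∧
        ((b ≡ᵇ suc a) ∨ ((a ≡ᵇ m) ∧ (b ≡ᵇ m + n ∸ 1))))

tadAdj : (m n : ℕ) → Fin (m + n) → Fin (m + n) → Bool
tadAdj m n u v =
  not (toℕ u ≡ᵇ toℕ v) ∧ (tadEdge m n (toℕ u) (toℕ v) ∨ tadEdge m n (toℕ v) (toℕ u))

private
  ≡ᵇ-refl : ∀ k → (k ≡ᵇ k) ≡ true
  ≡ᵇ-refl zero    = refl
  ≡ᵇ-refl (suc k) = ≡ᵇ-refl k

  ≡ᵇ-sym : ∀ a b → (a ≡ᵇ b) ≡ (b ≡ᵇ a)
  ≡ᵇ-sym zero zero = refl
  ≡ᵇ-sym zero (suc b) = refl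
  ≡ᵇ-sym (suc a) zero = refl
  ≡ᵇ-sym (suc a) (suc b) = ≡ᵇ-sym a b

tadpole : (m n : ℕ) → Graph (m + n)
tadpole m n = record
  { adj    = tadAdj m n
  ; sym    = λ u v → cong₂ _∧_ (cong not (≡ᵇ-sym (toℕ u) (toℕ v)))
                       (∨-comm (tadEdge m n (toℕ u) (toℕ v)) (tadEdge m n (toℕ v) (toℕ u)))
  ; irrefl = λ u → cong (λ b → not b ∧ (tadEdge m n (toℕ u) (toℕ u) ∨ tadEdge m n (toℕ u) (toℕ u))) (≡ᵇ-refl (toℕ u))
  }

module Submission where

-- We read off from the coefficients
-- of Q the following invariants of a graph G on N vertices:
--   * N itself                                   (coefficient of x y),
--   * Σ_v deg v = 2|E|                           (x² y: connected 2-sets),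
--   * Σ_v (deg v)²                               (x³ y and x³ y³: the 3-sets
--                                                 with one and three components),
--   * whether G is connected                     (x^N y),
--   * how many vertex-deleted subgraphs G - v are connected   (x^{N-1} y).
-- For T we have Σ deg = 2N and Σ deg² = 4N + 2, which forces H to have one
-- vertex of degree 1, one of degree 3 and all others of degree 2.  Walking
-- from the leaf, a connected graph with this degree sequence is a
-- "path with a chord": its vertices can be listed as 0, …, N-1 so that the
-- edges are i — i+1 and p — (N-1) for some 1 ≤ p ≤ N-3.  In such a graph
-- exactly N - p vertex deletions leave it connected, so the last invariant
-- gives p = m, and the listing is an isomorphism H ≅ T_{m,n}.

open import Defs hiding (sym)
open import Data.Nat using (ℕ; zero; suc; _+_; _*_; _∸_; _≤_; _<_; z≤n; s≤s; s≤s⁻¹; _≡ᵇ_; _<ᵇ_; _≤ᵇ_)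
open import Data.Nat.Properties
open import Data.Bool as B using (Bool; true; false; _∧_; _∨_; not)
open import Data.Bool.Properties using (∧-comm; ∧-identityʳ; ∨-identityʳ; ∧-zeroʳ)
open import Data.Fin as F using (Fin; zero; suc; toℕ; fromℕ<)
import Data.Fin.Properties as FP
import Data.Fin.Permutation as Perm
open import Data.Vec using ([]; _∷_; lookup; tabulate)
open import Data.Vec.Properties using (tabulate-cong; lookup∘tabulate)
open import Data.Fin.Subset using (Subset; inside; outside; ∣_∣)
import Data.List as List
open import Data.List using (List; _++_; map)
open import Data.List.Base using (allFin)
open import Data.Bool.ListAction using (any)
open import Data.Maybe using (Maybe; just; nothing; fromMaybe)
open import Data.Product using (Σ; _×_; _,_; proj₁; proj₂; ∃)
open import Data.Sum using (_⊎_; inj₁; inj₂)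
open import Relation.Binary.PropositionalEquality
open import Relation.Nullary
open import Relation.Nullary.Decidable using (does; dec-true)
open import Data.Empty
open import Function using (_∘_; id)
open import Relation.Binary.Definitions using (tri<; tri≈; tri>)
open import Data.Nat.Tactic.RingSolver using (solve-∀)
open import Algebra.Properties.CommutativeMonoid.Sum +-0-commutativeMonoid
  using (sum; ∑-comm; ∑-distrib-+; sum-permute; sum-cong-≗)
open import Algebra.Properties.Semiring.Sum +-*-semiring using (*-distribˡ-sum)

ind : Bool → ℕ
ind true = 1
ind false = 0

∨-true : ∀ a b → a ∨ b ≡ true → a ≡ true ⊎ b ≡ true
∨-true true b e = inj₁ refl
∨-true false b e = inj₂ e

∧-true : ∀ a b → a ∧ b ≡ true → a ≡ true × b ≡ true
∧-true true true e = refl , refl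

∧-intro : ∀ {a b} → a ≡ true → b ≡ true → a ∧ b ≡ true
∧-intro refl refl = refl

∨-introˡ : ∀ {a} b → a ≡ true → a ∨ b ≡ true
∨-introˡ b refl = refl

∨-introʳ : ∀ a {b} → b ≡ true → a ∨ b ≡ true
∨-introʳ true e = refl
∨-introʳ false e = e

∧-falseˡ : ∀ {a b} → a ≡ false → a ∧ b ≡ false
∧-falseˡ refl = refl

∨-false : ∀ {a b} → a ≡ false → b ≡ false → (a ∨ b) ≡ false
∨-false refl refl = refl

not-false : ∀ {a} → a ≡ false → not a ≡ true
not-false refl = refl

¬true : ∀ {a} → ¬ (a ≡ true) → a ≡ false
¬true {true} h = ⊥-elim (h refl)
¬true {false} h = refl

¬false : ∀ {a} → ¬ (a ≡ false) → a ≡ true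
¬false {true} h = refl
¬false {false} h = ⊥-elim (h refl)

t≢f : ∀ {a} → a ≡ true → a ≡ false → ⊥
t≢f refl ()

boolEq : ∀ {x y} → (x ≡ true → y ≡ true) → (y ≡ true → x ≡ true) → x ≡ y
boolEq {true} {y} f g = sym (f refl)
boolEq {false} {true} f g = g refl
boolEq {false} {false} f g = refl

ind-1 : ∀ b → ind b ≡ 1 → b ≡ true
ind-1 true _ = refl

ind≤1 : ∀ b → ind b ≤ 1
ind≤1 true = s≤s z≤n
ind≤1 false = z≤n

ind-mono : ∀ {a b} → (a ≡ true → b ≡ true) → ind a ≤ ind b
ind-mono {true} h rewrite h refl = ≤-refl
ind-mono {false} h = z≤n

decImp : (a b : Bool) → Dec (a ≡ true → b ≡ true)
decImp _ true = yes (λ _ → refl)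
decImp true false = no (λ h → t≢f (h refl) refl)
decImp false false = yes (λ ())

notImp : ∀ a b → ¬ (a ≡ true → b ≡ true) → ind b < ind a
notImp true true h = ⊥-elim (h (λ _ → refl))
notImp true false h = s≤s z≤n
notImp false b h = ⊥-elim (h (λ ()))

eqF : ∀ {n} → Fin n → Fin n → Bool
eqF a b = does (a FP.≟ b)

eqF-refl : ∀ {n} (a : Fin n) → eqF a a ≡ true
eqF-refl zero = refl
eqF-refl (suc a) = eqF-refl a

eqF-intro : ∀ {n} {a b : Fin n} → a ≡ b → eqF a b ≡ true
eqF-intro {a = a} refl = eqF-refl a

eqF-true : ∀ {n} {a b : Fin n} → eqF a b ≡ true → a ≡ b
eqF-true {a = a} {b} e with a FP.≟ b
... | yes p = p
eqF-true {a = a} {b} () | no _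

eqF-false : ∀ {n} {a b : Fin n} → ¬ a ≡ b → eqF a b ≡ false
eqF-false {a = a} {b} h with a FP.≟ b
... | yes p = ⊥-elim (h p)
... | no _ = refl

eqF-sym : ∀ {n} (a b : Fin n) → eqF a b ≡ eqF b a
eqF-sym a b with a FP.≟ b | b FP.≟ a
... | yes p | yes q = refl
... | yes p | no q = ⊥-elim (q (sym p))
... | no p | yes q = ⊥-elim (p (sym q))
... | no p | no q = refl

ltF : ∀ {n} → Fin n → Fin n → Bool
ltF a b = does (a FP.<? b)

doesT : ∀ {A : Set} (d : Dec A) → does d ≡ true → A
doesT (yes p) e = p

ltF-true : ∀ {n} {a b : Fin n} → ltF a b ≡ true → toℕ a < toℕ b
ltF-true {a = a} {b} e = doesT (a FP.<? b) e

ltF-intro : ∀ {n} {a b : Fin n} → toℕ a < toℕ b → ltF a b ≡ true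
ltF-intro {a = a} {b} h = dec-true (a FP.<? b) h

eqb-true : ∀ x y → (x ≡ᵇ y) ≡ true → x ≡ y
eqb-true zero zero _ = refl
eqb-true (suc x) (suc y) e = cong suc (eqb-true x y e)

eqb-refl : ∀ x → (x ≡ᵇ x) ≡ true
eqb-refl zero = refl
eqb-refl (suc x) = eqb-refl x

eqb-intro : ∀ {x y} → x ≡ y → (x ≡ᵇ y) ≡ true
eqb-intro {x} refl = eqb-refl x

eqb-false : ∀ x y → ¬ x ≡ y → (x ≡ᵇ y) ≡ false
eqb-false x y ne = ¬true (λ e → ne (eqb-true x y e))

eqb-sym : ∀ x y → (x ≡ᵇ y) ≡ (y ≡ᵇ x)
eqb-sym zero zero = refl
eqb-sym zero (suc y) = refl
eqb-sym (suc x) zero = refl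
eqb-sym (suc x) (suc y) = eqb-sym x y

ltb-true : ∀ x y → (x <ᵇ y) ≡ true → x < y
ltb-true zero (suc y) _ = s≤s z≤n
ltb-true (suc x) (suc y) e = s≤s (ltb-true x y e)

ltb-intro : ∀ {x y} → x < y → (x <ᵇ y) ≡ true
ltb-intro {zero} (s≤s _) = refl
ltb-intro {suc x} (s≤s lt) = ltb-intro lt

ltb-false : ∀ x y → ¬ x < y → (x <ᵇ y) ≡ false
ltb-false x y ne = ¬true (λ e → ne (ltb-true x y e))

leb-intro : ∀ {x y} → x ≤ y → (x ≤ᵇ y) ≡ true
leb-intro {zero} _ = refl
leb-intro {suc x} lt = ltb-intro lt

≡ᵇ-1 : ∀ k → 2 ≤ k → (k ≡ᵇ 1) ≡ false
≡ᵇ-1 (suc (suc k)) _ = refl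
≡ᵇ-1 (suc zero) (s≤s ())

1≤-≢0 : ∀ {a} → ¬ a ≡ 0 → 1 ≤ a
1≤-≢0 {zero} ne = ⊥-elim (ne refl)
1≤-≢0 {suc a} _ = s≤s z≤n

S : ∀ n → (Fin n → ℕ) → ℕ
S n f = sum {n} f

S-cong : ∀ n {f g : Fin n → ℕ} → (∀ i → f i ≡ g i) → S n f ≡ S n g
S-cong n h = sum-cong-≗ h

S-zero : ∀ n → S n (λ _ → 0) ≡ 0
S-zero zero = refl
S-zero (suc n) = S-zero n

S-+ : ∀ n (f g : Fin n → ℕ) → S n (λ i → f i + g i) ≡ S n f + S n g
S-+ n f g = ∑-distrib-+ f g

S-*ˡ : ∀ n k (f : Fin n → ℕ) → S n (λ i → k * f i) ≡ k * S n f
S-*ˡ n k f = sym (*-distribˡ-sum k f)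

S-*ʳ : ∀ n (f : Fin n → ℕ) k → S n (λ i → f i * k) ≡ S n f * k
S-*ʳ n f k = trans (S-cong n (λ i → *-comm (f i) k)) (trans (S-*ˡ n k f) (*-comm k _))

S-const : ∀ n k → S n (λ _ → k) ≡ n * k
S-const zero k = refl
S-const (suc n) k = cong (k +_) (S-const n k)

S-mono : ∀ n {f g : Fin n → ℕ} → (∀ i → f i ≤ g i) → S n f ≤ S n g
S-mono zero h = z≤n
S-mono (suc n) h = +-mono-≤ (h zero) (S-mono n (h ∘ suc))

S-strict : ∀ n {f g : Fin n → ℕ} → (∀ i → f i ≤ g i) → (i₀ : Fin n) → f i₀ < g i₀ → S n f < S n g
S-strict (suc n) h zero lt = +-mono-<-≤ lt (S-mono n (h ∘ suc))
S-strict (suc n) h (suc i) lt = +-mono-≤-< (h zero) (S-strict n (h ∘ suc) i lt)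

S-point : ∀ n (f : Fin n → ℕ) i → f i ≤ S n f
S-point (suc n) f zero = m≤m+n (f zero) _
S-point (suc n) f (suc i) = ≤-trans (S-point n (f ∘ suc) i) (m≤n+m _ (f zero))

S-ind≤ : ∀ n (f : Fin n → Bool) → S n (λ i → ind (f i)) ≤ n
S-ind≤ n f = ≤-trans (S-mono n (λ i → ind≤1 (f i))) (≤-reflexive (trans (S-const n 1) (*-identityʳ n)))

perm-S : ∀ N (g gi : Fin N → Fin N) → (∀ v → g (gi v) ≡ v) → (∀ i → gi (g i) ≡ i) →
  ∀ (f : Fin N → ℕ) → S N f ≡ S N (λ i → f (g i))
perm-S N g gi e1 e2 f = sum-permute f (Perm.permutation g gi e1 e2)

S-single : ∀ n (a : Fin n) → S n (λ v → ind (eqF a v)) ≡ 1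
S-single (suc n) zero = cong suc (S-zero n)
S-single (suc n) (suc a) = S-single n a

S-pair : ∀ n (a b : Fin n) → ¬ a ≡ b → S n (λ u → ind (eqF a u ∨ eqF b u)) ≡ 2
S-pair n a b ne = trans (S-cong n pt) (trans (S-+ n _ _) (cong₂ _+_ (S-single n a) (S-single n b)))
  where
  pt : ∀ u → ind (eqF a u ∨ eqF b u) ≡ ind (eqF a u) + ind (eqF b u)
  pt u with a FP.≟ u | b FP.≟ u
  ... | yes refl | yes refl = ⊥-elim (ne refl)
  ... | yes _ | no _ = refl
  ... | no _ | yes _ = refl
  ... | no _ | no _ = refl

S-triple : ∀ n (a b c : Fin n) → ¬ a ≡ b → ¬ a ≡ c → ¬ b ≡ c →
  S n (λ u → ind (eqF a u ∨ eqF b u ∨ eqF c u)) ≡ 3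
S-triple n a b c ab ac bc = trans (S-cong n pt) (trans (S-+ n _ _) (cong₂ _+_ (S-single n a) (S-pair n b c bc)))
  where
  pt : ∀ u → ind (eqF a u ∨ eqF b u ∨ eqF c u) ≡ ind (eqF a u) + ind (eqF b u ∨ eqF c u)
  pt u with a FP.≟ u | b FP.≟ u | c FP.≟ u
  ... | yes refl | yes refl | _ = ⊥-elim (ab refl)
  ... | yes refl | no _ | yes refl = ⊥-elim (ac refl)
  ... | yes _ | no _ | no _ = refl
  ... | no _ | _ | _ = refl

S-two : ∀ n (f : Fin n → Bool) (a b : Fin n) → ¬ a ≡ b → f a ≡ true → f b ≡ true →
  2 ≤ S n (λ i → ind (f i))
S-two n f a b a≢b fa fb =
  subst (_≤ S n (λ i → ind (f i))) (S-pair n a b a≢b) (S-mono n pt)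
  where
  pt : ∀ v → ind (eqF a v ∨ eqF b v) ≤ ind (f v)
  pt v with a FP.≟ v | b FP.≟ v
  ... | yes refl | _ rewrite fa = ≤-refl
  ... | no _ | yes refl rewrite fb = ≤-refl
  ... | no _ | no _ = z≤n

S-exact1 : ∀ n (f : Fin n → Bool) (a : Fin n) → (∀ v → f v ≡ eqF a v) → S n (λ i → ind (f i)) ≡ 1
S-exact1 n f a h = trans (S-cong n (λ v → cong ind (h v))) (S-single n a)

count-tab : ∀ {A : Set} (p : A → Bool) n (g : Fin n → A) →
  count p (List.tabulate g) ≡ S n (λ i → ind (p (g i)))
count-tab p zero g = refl
count-tab p (suc n) g with p (g zero)
... | true = cong suc (count-tab p n (g ∘ suc))
... | false = count-tab p n (g ∘ suc)

count-allFin : ∀ n (p : Fin n → Bool) → count p (allFin n) ≡ S n (λ i → ind (p i))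
count-allFin n p = count-tab p n id

any-tab-true : ∀ {A : Set} (p : A → Bool) n (g : Fin n → A) →
  any p (List.tabulate g) ≡ true → ∃ λ i → p (g i) ≡ true
any-tab-true p (suc n) g e with p (g zero) in eq
... | true = zero , eq
... | false with any-tab-true p n (g ∘ suc) e
... | i , h = suc i , h

any-tab-intro : ∀ {A : Set} (p : A → Bool) n (g : Fin n → A) (i : Fin n) →
  p (g i) ≡ true → any p (List.tabulate g) ≡ true
any-tab-intro p (suc n) g zero h rewrite h = refl
any-tab-intro p (suc n) g (suc i) h = ∨-introʳ (p (g zero)) (any-tab-intro p n (g ∘ suc) i h)

any-allFin-true : ∀ n (p : Fin n → Bool) → any p (allFin n) ≡ true → ∃ λ i → p i ≡ true
any-allFin-true n p = any-tab-true p n id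

any-allFin-intro : ∀ n (p : Fin n → Bool) (i : Fin n) → p i ≡ true → any p (allFin n) ≡ true
any-allFin-intro n p = any-tab-intro p n id

least : ∀ {n} (P : Fin n → Bool) (x : Fin n) → P x ≡ true →
  Σ (Fin n) λ a → P a ≡ true × (∀ u → toℕ u < toℕ a → P u ≡ false)
least {suc n} P x px with P zero in e0
... | true = zero , e0 , λ u ()
... | false with x
... | zero = ⊥-elim (t≢f px e0)
... | suc x' with least (P ∘ suc) x' px
... | a , pa , la = suc a , pa , lem
  where
  lem : ∀ u → toℕ u < toℕ (suc a) → P u ≡ false
  lem zero _ = e0
  lem (suc u) (s≤s lt) = la u lt

least-≤ : ∀ {n} (P : Fin n → Bool) (a : Fin n) → (∀ u → toℕ u < toℕ a → P u ≡ false) →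
  ∀ v → P v ≡ true → toℕ a ≤ toℕ v
least-≤ P a la v pv with toℕ a ≤? toℕ v
... | yes p = p
... | no q = ⊥-elim (t≢f pv (la v (≰⇒> q)))

module Walks {N : ℕ} (G : Graph N) (X : Subset N) where

  wk : ℕ → Fin N → Fin N → Bool
  wk = walk G X

  mem : Fin N → Bool
  mem = lookup X

  walk-last : ∀ t u v → wk (suc t) u v ≡ true →
    wk t u v ≡ true ⊎ Σ (Fin N) λ w → wk t u w ≡ true × mem v ≡ true × adj G w v ≡ true
  walk-last t u v e with ∨-true (wk t u v) _ e
  ... | inj₁ h = inj₁ h
  ... | inj₂ h with any-allFin-true N _ h
  ... | w , hw with ∧-true (wk t u w) _ hw
  ... | h1 , h2 with ∧-true (mem v) _ h2
  ... | h3 , h4 = inj₂ (w , h1 , h3 , h4)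

  walk0-eq : ∀ u v → wk zero u v ≡ true → u ≡ v
  walk0-eq u v e = eqF-true (proj₁ (∧-true (eqF u v) _ e))

  walk-mem : ∀ t u v → wk t u v ≡ true → mem u ≡ true × mem v ≡ true
  walk-mem zero u v e with walk0-eq u v e
  ... | refl = proj₂ (∧-true _ _ e) , proj₂ (∧-true _ _ e)
  walk-mem (suc t) u v e with walk-last t u v e
  ... | inj₁ h = walk-mem t u v h
  ... | inj₂ (w , h , mv , _) = proj₁ (walk-mem t u w h) , mv

  walk-refl : ∀ u → mem u ≡ true → wk zero u u ≡ true
  walk-refl u h = trans (cong (_∧ mem u) (eqF-refl u)) h

  walk-mono1 : ∀ t u v → wk t u v ≡ true → wk (suc t) u v ≡ true
  walk-mono1 t u v h = ∨-introˡ _ h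

  walk-mono≤ : ∀ {s t} u v → s ≤ t → wk s u v ≡ true → wk t u v ≡ true
  walk-mono≤ {s} {t} u v le h = subst (λ z → wk z u v ≡ true) (m∸n+n≡m le) (raise (t ∸ s) h)
    where
    raise : ∀ k → wk s u v ≡ true → wk (k + s) u v ≡ true
    raise zero h = h
    raise (suc k) h = walk-mono1 (k + s) u v (raise k h)

  walk-step : ∀ t u x y → wk t u x ≡ true → mem y ≡ true → adj G x y ≡ true → wk (suc t) u y ≡ true
  walk-step t u x y h my axy =
    ∨-introʳ (wk t u y) (any-allFin-intro N _ x (∧-intro h (∧-intro my axy)))

  walk-prepend : ∀ t u x v → mem u ≡ true → adj G u x ≡ true → wk t x v ≡ true → wk (suc t) u v ≡ true
  walk-prepend zero u x v mu aux h with walk0-eq x v h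
  ... | refl = walk-step zero u u x (walk-refl u mu) (proj₂ (walk-mem zero x x h)) aux
  walk-prepend (suc t) u x v mu aux h with walk-last t x v h
  ... | inj₁ h' = walk-mono1 (suc t) u v (walk-prepend t u x v mu aux h')
  ... | inj₂ (w , h' , mv , awv) = walk-step (suc t) u w v (walk-prepend t u x w mu aux h') mv awv

  walk-sym : ∀ t u v → wk t u v ≡ true → wk t v u ≡ true
  walk-sym zero u v h with walk0-eq u v h
  ... | refl = h
  walk-sym (suc t) u v h with walk-last t u v h
  ... | inj₁ h' = walk-mono1 t v u (walk-sym t u v h')
  ... | inj₂ (w , h' , mv , awv) = walk-prepend t v w u mv (trans (Graph.sym G v w) awv) (walk-sym t u w h')

  walk-trans : ∀ s t u v x → wk s u v ≡ true → wk t v x ≡ true → wk (t + s) u x ≡ true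
  walk-trans s zero u v x h1 h2 with walk0-eq v x h2
  ... | refl = h1
  walk-trans s (suc t) u v x h1 h2 with walk-last t v x h2
  ... | inj₁ h' = walk-mono1 (t + s) u x (walk-trans s t u v x h1 h')
  ... | inj₂ (w , h' , mx , awx) = walk-step (t + s) u w x (walk-trans s t u v w h1 h') mx awx

  walk-pres : (Sb : Fin N → Bool) →
    (∀ x y → mem x ≡ true → mem y ≡ true → adj G x y ≡ true → Sb x ≡ Sb y) →
    ∀ t u v → wk t u v ≡ true → Sb u ≡ Sb v
  walk-pres Sb closed zero u v h with walk0-eq u v h
  ... | refl = refl
  walk-pres Sb closed (suc t) u v h with walk-last t u v h
  ... | inj₁ h' = walk-pres Sb closed t u v h'
  ... | inj₂ (w , h' , mv , awv) =
    trans (walk-pres Sb closed t u w h') (closed w v (proj₂ (walk-mem t u w h')) mv awv)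

-- Walks of length N suffice: the set of vertices reachable from u in at
-- most t steps grows strictly until it stabilises, and it has at most N
-- elements.
module WalkBound {N : ℕ} (G : Graph N) (X : Subset N) (u : Fin N) (mu : lookup X u ≡ true) where
  open Walks G X

  R : ℕ → ℕ
  R t = S N (λ v → ind (wk t u v))

  settled : ℕ → Set
  settled t = ∀ v → wk (suc t) u v ≡ true → wk t u v ≡ true

  settled-suc : ∀ t → settled t → settled (suc t)
  settled-suc t st v h with walk-last (suc t) u v h
  ... | inj₁ h' = h'
  ... | inj₂ (w , h' , mv , awv) = walk-step t u w v (st w h') mv awv

  settled-forever : ∀ k t → settled t → ∀ v → wk (k + t) u v ≡ true → wk t u v ≡ true
  settled-forever zero t st v h = h
  settled-forever (suc k) t st v h = settled-forever k t st v (later k v h)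
    where
    later : ∀ k → settled (k + t)
    later zero = st
    later (suc k) = settled-suc (k + t) (later k)

  settled? : ∀ t → Dec (settled t)
  settled? t = FP.all? (λ v → decImp (wk (suc t) u v) (wk t u v))

  grow : ∀ t → ¬ settled t → suc (R t) ≤ R (suc t)
  grow t ns with FP.¬∀⟶∃¬ N _ (λ v → decImp (wk (suc t) u v) (wk t u v)) ns
  ... | v₀ , nv = S-strict N (λ v → ind-mono (walk-mono1 t u v)) v₀ (notImp _ _ nv)

  settled-or-large : ∀ t → (Σ ℕ λ t₀ → t₀ ≤ t × settled t₀) ⊎ (suc t ≤ R t)
  settled-or-large zero =
    inj₂ (≤-trans (≤-reflexive (cong ind (sym (walk-refl u mu)))) (S-point N (λ v → ind (wk zero u v)) u))
  settled-or-large (suc t) with settled-or-large t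
  ... | inj₁ (t₀ , le , st) = inj₁ (t₀ , m≤n⇒m≤1+n le , st)
  ... | inj₂ le with settled? t
  ... | yes st = inj₁ (t , n≤1+n t , st)
  ... | no ns = inj₂ (≤-trans (s≤s le) (grow t ns))

  settled-by-N : Σ ℕ λ t₀ → t₀ ≤ N × settled t₀
  settled-by-N with settled-or-large N
  ... | inj₁ r = r
  ... | inj₂ le = ⊥-elim (<⇒≱ le (S-ind≤ N (λ v → wk N u v)))

  walk-to-N : ∀ t v → wk t u v ≡ true → wk N u v ≡ true
  walk-to-N t v h with t ≤? N
  ... | yes le = walk-mono≤ u v le h
  ... | no gt with settled-by-N
  ... | t₀ , le , st =
    walk-mono≤ u v le (settled-forever (t ∸ t₀) t₀ st v
      (subst (λ z → wk z u v ≡ true) (sym (m∸n+n≡m (≤-trans le (<⇒≤ (≰⇒> gt))))) h))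

conn-intro : ∀ {N} (G : Graph N) (X : Subset N) t u v → walk G X t u v ≡ true → connected G X u v ≡ true
conn-intro G X t u v h = WalkBound.walk-to-N G X u (proj₁ (Walks.walk-mem G X t u v h)) t v h

conn-sym : ∀ {N} (G : Graph N) (X : Subset N) u v → connected G X u v ≡ true → connected G X v u ≡ true
conn-sym {N} G X u v h = Walks.walk-sym G X N u v h

conn-trans : ∀ {N} (G : Graph N) (X : Subset N) u v x →
  connected G X u v ≡ true → connected G X v x ≡ true → connected G X u x ≡ true
conn-trans {N} G X u v x h1 h2 = conn-intro G X (N + N) u x (Walks.walk-trans G X N N u v x h1 h2)

conn-refl : ∀ {N} (G : Graph N) (X : Subset N) u → lookup X u ≡ true → connected G X u u ≡ true
conn-refl G X u h = conn-intro G X zero u u (Walks.walk-refl G X u h)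

conn-adj : ∀ {N} (G : Graph N) (X : Subset N) u v → lookup X u ≡ true → lookup X v ≡ true →
  adj G u v ≡ true → connected G X u v ≡ true
conn-adj G X u v hu hv a = conn-intro G X 1 u v (Walks.walk-step G X zero u u v (Walks.walk-refl G X u hu) hv a)

conn-mem : ∀ {N} (G : Graph N) (X : Subset N) u v → connected G X u v ≡ true →
  lookup X u ≡ true × lookup X v ≡ true
conn-mem {N} G X u v h = Walks.walk-mem G X N u v h

conn-pres : ∀ {N} (G : Graph N) (X : Subset N) (Sb : Fin N → Bool) →
  (∀ x y → lookup X x ≡ true → lookup X y ≡ true → adj G x y ≡ true → Sb x ≡ Sb y) →
  ∀ u v → connected G X u v ≡ true → Sb u ≡ Sb v
conn-pres {N} G X Sb closed u v = Walks.walk-pres G X Sb closed N u v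

conn-star : ∀ {N} (G : Graph N) (X : Subset N) (c : Fin N) →
  (∀ u → lookup X u ≡ true → connected G X c u ≡ true) →
  ∀ u v → lookup X u ≡ true → lookup X v ≡ true → connected G X u v ≡ true
conn-star G X c hc u v hu hv = conn-trans G X u c v (conn-sym G X c u (hc u hu)) (hc v hv)

comp-S : ∀ {N} (G : Graph N) (X : Subset N) → components G X ≡ S N (λ v → ind (isRep G X v))
comp-S {N} G X = count-allFin N (isRep G X)

one-component : ∀ {N} (G : Graph N) (X : Subset N) (x₀ : Fin N) → lookup X x₀ ≡ true →
  (∀ u v → lookup X u ≡ true → lookup X v ≡ true → connected G X u v ≡ true) →
  components G X ≡ 1
one-component {N} G X x₀ hx₀ allc with least (lookup X) x₀ hx₀
... | a , Xa , la = trans (comp-S G X) (S-exact1 N (isRep G X) a onlyA)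
  where
  -- the least vertex a of X is the only representative
  onlyA : ∀ v → isRep G X v ≡ eqF a v
  onlyA v with a FP.≟ v
  ... | yes refl = trans (cong (λ z → lookup X a ∧ not z) noSmaller) (cong (_∧ true) Xa)
    where
    noSmaller : any (λ u → does (u F.<? a) ∧ connected G X u a) (allFin N) ≡ false
    noSmaller = ¬true λ h → let (u , hu) = any-allFin-true N _ h
                                (h1 , h2) = ∧-true _ _ hu
                            in t≢f (proj₁ (conn-mem G X u a h2)) (la u (ltF-true h1))
  ... | no a≢v with lookup X v in Xv
  ... | false = refl
  ... | true = cong not (any-allFin-intro N _ a (∧-intro (ltF-intro a<v) (allc a v Xa Xv)))
    where
    a<v : toℕ a < toℕ v
    a<v = ≤∧≢⇒< (least-≤ (lookup X) a la v Xv) (λ e → a≢v (FP.toℕ-injective e))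

-- If a predicate Sb is constant across the edges of G[X] and takes both
-- values on X, then G[X] has at least two components: the least vertices
-- of X with Sb true and with Sb false are both representatives.
two-components : ∀ {N} (G : Graph N) (X : Subset N) (Sb : Fin N → Bool) (u₁ u₂ : Fin N) →
  lookup X u₁ ≡ true → lookup X u₂ ≡ true → Sb u₁ ≡ true → Sb u₂ ≡ false →
  (∀ x y → lookup X x ≡ true → lookup X y ≡ true → adj G x y ≡ true → Sb x ≡ Sb y) →
  2 ≤ components G X
two-components {N} G X Sb u₁ u₂ X1 X2 S1 S2 closed
  with least (λ v → lookup X v ∧ Sb v) u₁ (∧-intro X1 S1)
     | least (λ v → lookup X v ∧ not (Sb v)) u₂ (∧-intro X2 (not-false S2))
... | a , XSa , la | b , XSb , lb =
  subst (2 ≤_) (sym (comp-S G X)) (S-two N (isRep G X) a b a≢b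
    (leastRep a _ Xa la (λ u Xu e → ∧-intro Xu (trans e Sa)))
    (leastRep b _ Xb lb (λ u Xu e → ∧-intro Xu (trans (cong not e) Sb'))))
  where
  Xa : lookup X a ≡ true
  Xa = proj₁ (∧-true _ _ XSa)
  Sa : Sb a ≡ true
  Sa = proj₂ (∧-true _ _ XSa)
  Xb : lookup X b ≡ true
  Xb = proj₁ (∧-true _ _ XSb)
  Sb' : not (Sb b) ≡ true
  Sb' = proj₂ (∧-true _ _ XSb)

  a≢b : ¬ a ≡ b
  a≢b e = t≢f Sb' (cong not (subst (λ z → Sb z ≡ true) e Sa))

  leastRep : ∀ c (P : Fin N → Bool) → lookup X c ≡ true → (∀ u → toℕ u < toℕ c → P u ≡ false) →
    (∀ u → lookup X u ≡ true → Sb u ≡ Sb c → P u ≡ true) → isRep G X c ≡ true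
  leastRep c P Xc lc hP = ∧-intro Xc (not-false (¬true λ h →
    let (u , hu) = any-allFin-true N _ h
        (h1 , h2) = ∧-true _ _ hu
    in t≢f (hP u (proj₁ (conn-mem G X u c h2)) (conn-pres G X Sb closed u c h2)) (lc u (ltF-true h1))))

adj-irr : ∀ {N} (G : Graph N) {x y} → adj G x y ≡ true → ¬ x ≡ y
adj-irr G {x} h refl = t≢f h (irrefl G x)

isolated-closed : ∀ {N} (G : Graph N) (X : Subset N) (z : Fin N) →
  (∀ v → lookup X v ≡ true → adj G z v ≡ false) →
  ∀ x y → lookup X x ≡ true → lookup X y ≡ true → adj G x y ≡ true → eqF z x ≡ eqF z y
isolated-closed G X z isol x y Xx Xy a with z FP.≟ x | z FP.≟ y
... | yes refl | yes refl = refl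
... | yes refl | no _ = ⊥-elim (t≢f a (isol y Xy))
... | no _ | yes refl = ⊥-elim (t≢f (trans (Graph.sym G z x) a) (isol x Xx))
... | no _ | no _ = refl

iso-split : ∀ {N} (G : Graph N) (X : Subset N) (z w : Fin N) → lookup X z ≡ true → lookup X w ≡ true →
  ¬ z ≡ w → (∀ v → lookup X v ≡ true → adj G z v ≡ false) → 2 ≤ components G X
iso-split G X z w Xz Xw z≢w isol =
  two-components G X (eqF z) z w Xz Xw (eqF-refl z) (eqF-false z≢w) (isolated-closed G X z isol)

isol-rep : ∀ {N} (G : Graph N) (X : Subset N) (z : Fin N) → lookup X z ≡ true →
  (∀ v → lookup X v ≡ true → adj G z v ≡ false) → isRep G X z ≡ true
isol-rep {N} G X z Xz isol = ∧-intro Xz (not-false (¬true λ h →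
  let (u , hu) = any-allFin-true N _ h
      (h1 , h2) = ∧-true _ _ hu
      z≡u = eqF-true (trans (conn-pres G X (eqF z) (isolated-closed G X z isol) u z h2) (eqF-refl z))
  in <-irrefl (cong toℕ (sym z≡u)) (ltF-true {a = u} {b = z} h1)))

nonrep : ∀ {N} (G : Graph N) (X : Subset N) (p q : Fin N) → lookup X p ≡ true → lookup X q ≡ true →
  toℕ p < toℕ q → adj G p q ≡ true → isRep G X q ≡ false
nonrep {N} G X p q Xp Xq lt a =
  trans (cong (λ z → lookup X q ∧ not z) (any-allFin-intro N _ p (∧-intro (ltF-intro lt) (conn-adj G X p q Xp Xq a))))
        (∧-zeroʳ (lookup X q))

-- Counting subsets by size.  cnt N k P is the number of k-element
-- X ⊆ Fin N satisfying P, so that  Qcoeff G k j = cnt N k (k(G[X]) = j).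

cnt : ∀ N → ℕ → (Subset N → Bool) → ℕ
cnt N k P = count (λ X → (∣ X ∣ ≡ᵇ k) ∧ P X) (allSubsets N)

count-++ : ∀ {A : Set} (p : A → Bool) (xs ys : List A) → count p (xs ++ ys) ≡ count p xs + count p ys
count-++ p List.[] ys = refl
count-++ p (x List.∷ xs) ys with p x
... | true = cong suc (count-++ p xs ys)
... | false = count-++ p xs ys

count-map : ∀ {A B : Set} (p : B → Bool) (f : A → B) (xs : List A) → count p (map f xs) ≡ count (p ∘ f) xs
count-map p f List.[] = refl
count-map p f (x List.∷ xs) with p (f x)
... | true = cong suc (count-map p f xs)
... | false = count-map p f xs

count-false : ∀ {A : Set} (xs : List A) → count (λ _ → false) xs ≡ 0
count-false List.[] = refl
count-false (x List.∷ xs) = count-false xs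

-- Pascal's rule: a (k+1)-subset of Fin (N+1) omits or contains vertex 0.
cnt-split : ∀ N k P → cnt (suc N) (suc k) P ≡ cnt N (suc k) (P ∘ (outside ∷_)) + cnt N k (P ∘ (inside ∷_))
cnt-split N k P = trans (count-++ _ (map (outside ∷_) (allSubsets N)) _)
  (cong₂ _+_ (count-map _ (outside ∷_) (allSubsets N)) (count-map _ (inside ∷_) (allSubsets N)))

cnt-split0 : ∀ N P → cnt (suc N) zero P ≡ cnt N zero (P ∘ (outside ∷_))
cnt-split0 N P = trans (count-++ _ (map (outside ∷_) (allSubsets N)) _)
  (trans (cong₂ _+_ (count-map _ (outside ∷_) (allSubsets N)) (trans (count-map _ (inside ∷_) (allSubsets N)) (count-false (allSubsets N))))
    (+-identityʳ _))

empt : ∀ N → Subset N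
empt N = tabulate (λ _ → false)

full : ∀ N → Subset N
full N = tabulate (λ _ → true)

mem-full : ∀ {N} (v : Fin N) → lookup (full N) v ≡ true
mem-full v = lookup∘tabulate (λ _ → true) v

cnt0 : ∀ N P → cnt N zero P ≡ ind (P (empt N))
cnt0 zero P with P []
... | true = refl
... | false = refl
cnt0 (suc N) P = trans (cnt-split0 N P) (cnt0 N (P ∘ (outside ∷_)))

cnt-big : ∀ N k P → N < k → cnt N k P ≡ 0
cnt-big zero (suc k) P lt = refl
cnt-big (suc N) (suc k) P (s≤s lt) = trans (cnt-split N k P)
  (cong₂ _+_ (cnt-big N (suc k) _ (m≤n⇒m≤1+n lt)) (cnt-big N k _ lt))

cntN : ∀ N P → cnt N N P ≡ ind (P (full N))
cntN zero P with P []
... | true = refl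
... | false = refl
cntN (suc N) P = trans (cnt-split N N P) (trans (cong₂ _+_ (cnt-big N (suc N) _ ≤-refl) (cntN N _)) refl)

co1 : ∀ {N} → Fin N → Subset N
co1 a = tabulate (λ v → not (eqF a v))

cntN-1 : ∀ N P → cnt (suc N) N P ≡ S (suc N) (λ a → ind (P (co1 a)))
cntN-1 zero P = trans (cnt-split0 zero P) (trans (cnt0 zero (P ∘ (outside ∷_))) (sym (+-identityʳ (ind (P (outside ∷ []))))))
cntN-1 (suc N) P = trans (cnt-split (suc N) N P)
  (cong₂ _+_ (cntN (suc N) _) (cntN-1 N (P ∘ (inside ∷_))))

sub1 : ∀ {N} → Fin N → Subset N
sub1 a = tabulate (eqF a)

sub2 : ∀ {N} → Fin N → Fin N → Subset N
sub2 a b = tabulate (λ v → eqF a v ∨ eqF b v)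

sub3 : ∀ {N} → Fin N → Fin N → Fin N → Subset N
sub3 a b c = tabulate (λ v → eqF a v ∨ eqF b v ∨ eqF c v)

cnt1 : ∀ N P → cnt N 1 P ≡ S N (λ a → ind (P (sub1 a)))
cnt1 zero P = refl
cnt1 (suc N) P = trans (cnt-split N zero P)
  (trans (cong₂ _+_ (cnt1 N (P ∘ (outside ∷_))) (cnt0 N (P ∘ (inside ∷_))))
    (+-comm (S N (λ a → ind (P (outside ∷ sub1 a)))) (ind (P (inside ∷ empt N)))))

D2 : ∀ N → (Subset N → Bool) → ℕ
D2 N P = S N (λ a → S N (λ b → ind (not (eqF a b) ∧ P (sub2 a b))))

-- every 2-set arises from two ordered pairs
cnt2 : ∀ N P → 2 * cnt N 2 P ≡ D2 N P
cnt2 zero P = refl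
cnt2 (suc N) P = begin
  2 * cnt (suc N) 2 P ≡⟨ cong (2 *_) (cnt-split N 1 P) ⟩
  2 * (c2 + c1) ≡⟨ *-distribˡ-+ 2 c2 c1 ⟩
  2 * c2 + 2 * c1 ≡⟨ cong₂ _+_ (cnt2 N Po) (cong (λ z → c1 + (c1 + z)) (sym (+-identityʳ 0)) ) ⟩
  D2 N Po + (c1 + (c1 + 0)) ≡⟨ cong (λ z → D2 N Po + (c1 + z)) (+-identityʳ c1) ⟩
  D2 N Po + (c1 + c1) ≡⟨ cong (λ z → D2 N Po + (z + c1)) (cnt1 N Pi) ⟩
  D2 N Po + (A + c1) ≡⟨ cong (λ z → D2 N Po + (A + z)) (cnt1 N Pi) ⟩
  D2 N Po + (A + A) ≡⟨ cong (λ z → D2 N Po + (A + z)) (S-cong N (λ a → cong (λ s → ind (Pi s)) (tabulate-cong (λ v → sym (∨-identityʳ (eqF a v)))))) ⟩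
  D2 N Po + (A + B) ≡⟨ solve ⟩
  A + (B + D2 N Po) ≡⟨ cong (A +_) (sym (S-+ N _ _)) ⟩
  A + S N (λ a → ind (P (inside ∷ tabulate (λ v → eqF a v ∨ false))) + S N (λ b → ind (not (eqF a b) ∧ P (outside ∷ sub2 a b)))) ∎
  where
  open ≡-Reasoning
  Po Pi : Subset N → Bool
  Po = P ∘ (outside ∷_)
  Pi = P ∘ (inside ∷_)
  c2 c1 A B : ℕ
  c2 = cnt N 2 Po
  c1 = cnt N 1 Pi
  A = S N (λ a → ind (Pi (sub1 a)))
  B = S N (λ a → ind (P (inside ∷ tabulate (λ v → eqF a v ∨ false))))
  solve : D2 N Po + (A + B) ≡ A + (B + D2 N Po)
  solve = trans (+-comm (D2 N Po) _) (+-assoc A B _)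

dist3 : ∀ {N} → Fin N → Fin N → Fin N → Bool
dist3 a b c = not (eqF a b) ∧ not (eqF a c) ∧ not (eqF b c)

D3 : ∀ N → (Subset N → Bool) → ℕ
D3 N P = S N (λ a → S N (λ b → S N (λ c → ind (dist3 a b c ∧ P (sub3 a b c)))))

-- every 3-set arises from six ordered triples
cnt3 : ∀ N P → 6 * cnt N 3 P ≡ D3 N P
cnt3 zero P = refl
cnt3 (suc N) P = sym (begin
  D3 (suc N) P ≡⟨⟩
  (S (suc N) (λ _ → 0) + D2 N Pi) + S N (λ a → S N (T1 a) + S N (λ b → T2 a b + S N (F a b)))
    ≡⟨ cong₂ _+_ (cong (_+ D2 N Pi) (S-zero (suc N))) (S-cong N (λ a → cong (S N (T1 a) +_) (S-+ N (T2 a) (λ b → S N (F a b))))) ⟩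
  D2 N Pi + S N (λ a → S N (T1 a) + (S N (T2 a) + S N (λ b → S N (F a b))))
    ≡⟨ cong (D2 N Pi +_) (S-+ N _ _) ⟩
  D2 N Pi + (S N (λ a → S N (T1 a)) + S N (λ a → S N (T2 a) + S N (λ b → S N (F a b))))
    ≡⟨ cong (λ z → D2 N Pi + (S N (λ a → S N (T1 a)) + z)) (S-+ N _ _) ⟩
  D2 N Pi + (S N (λ a → S N (T1 a)) + (S N (λ a → S N (T2 a)) + D3 N Po))
    ≡⟨ cong₂ (λ x y → D2 N Pi + (x + (y + D3 N Po))) e1 e2 ⟩
  D2 N Pi + (D2 N Pi + (D2 N Pi + D3 N Po))
    ≡⟨ cong (λ z → z + (z + (z + D3 N Po))) (sym (cnt2 N Pi)) ⟩
  2 * c2 + (2 * c2 + (2 * c2 + D3 N Po))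
    ≡⟨ cong (λ z → 2 * c2 + (2 * c2 + (2 * c2 + z))) (sym (cnt3 N Po)) ⟩
  2 * c2 + (2 * c2 + (2 * c2 + 6 * c3)) ≡⟨ arith6 c2 c3 ⟩
  6 * (c3 + c2) ≡⟨ cong (6 *_) (sym (cnt-split N 2 P)) ⟩
  6 * cnt (suc N) 3 P ∎)
  where
  open ≡-Reasoning
  arith6 : ∀ x y → 2 * x + (2 * x + (2 * x + 6 * y)) ≡ 6 * (y + x)
  arith6 = solve-∀
  Po Pi : Subset N → Bool
  Po = P ∘ (outside ∷_)
  Pi = P ∘ (inside ∷_)
  c2 c3 : ℕ
  c2 = cnt N 2 Pi
  c3 = cnt N 3 Po
  T1 : Fin N → Fin N → ℕ
  T1 a c = ind ((not (eqF a c) ∧ true) ∧ P (inside ∷ sub2 a c))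
  T2 : Fin N → Fin N → ℕ
  T2 a b = ind ((not (eqF a b) ∧ true) ∧ P (inside ∷ tabulate (λ v → eqF a v ∨ eqF b v ∨ false)))
  F : Fin N → Fin N → Fin N → ℕ
  F a b c = ind (dist3 a b c ∧ Po (sub3 a b c))
  e1 : S N (λ a → S N (T1 a)) ≡ D2 N Pi
  e1 = S-cong N (λ a → S-cong N (λ c → cong (λ z → ind (z ∧ Pi (sub2 a c))) (∧-identityʳ _)))
  e2 : S N (λ a → S N (T2 a)) ≡ D2 N Pi
  e2 = S-cong N (λ a → S-cong N (λ b → cong₂ (λ z s → ind (z ∧ Pi s)) (∧-identityʳ _)
         (tabulate-cong (λ v → cong (eqF a v ∨_) (∨-identityʳ (eqF b v))))))


mem1 : ∀ {N} (a v : Fin N) → lookup (sub1 a) v ≡ eqF a v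
mem1 a v = lookup∘tabulate (eqF a) v

mem2 : ∀ {N} (a b v : Fin N) → lookup (sub2 a b) v ≡ (eqF a v ∨ eqF b v)
mem2 a b v = lookup∘tabulate (λ v → eqF a v ∨ eqF b v) v

mem3 : ∀ {N} (a b c v : Fin N) → lookup (sub3 a b c) v ≡ (eqF a v ∨ eqF b v ∨ eqF c v)
mem3 a b c v = lookup∘tabulate (λ v → eqF a v ∨ eqF b v ∨ eqF c v) v

in2 : ∀ {N} (a b v : Fin N) → (eqF a v ∨ eqF b v) ≡ true → v ≡ a ⊎ v ≡ b
in2 a b v h with ∨-true (eqF a v) _ h
... | inj₁ e = inj₁ (sym (eqF-true e))
... | inj₂ e = inj₂ (sym (eqF-true e))

in3 : ∀ {N} (a b c v : Fin N) → (eqF a v ∨ eqF b v ∨ eqF c v) ≡ true → v ≡ a ⊎ v ≡ b ⊎ v ≡ c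
in3 a b c v h with ∨-true (eqF a v) _ h
... | inj₁ e = inj₁ (sym (eqF-true e))
... | inj₂ e with in2 b c v e
... | inj₁ e' = inj₂ (inj₁ e')
... | inj₂ e' = inj₂ (inj₂ e')

m1a : ∀ {N} (a : Fin N) → lookup (sub1 a) a ≡ true
m1a a = trans (mem1 a a) (eqF-refl a)

m2a : ∀ {N} (a b : Fin N) → lookup (sub2 a b) a ≡ true
m2a a b = trans (mem2 a b a) (∨-introˡ _ (eqF-refl a))

m2b : ∀ {N} (a b : Fin N) → lookup (sub2 a b) b ≡ true
m2b a b = trans (mem2 a b b) (∨-introʳ (eqF a b) (eqF-refl b))

m3a : ∀ {N} (a b c : Fin N) → lookup (sub3 a b c) a ≡ true
m3a a b c = trans (mem3 a b c a) (∨-introˡ _ (eqF-refl a))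

m3b : ∀ {N} (a b c : Fin N) → lookup (sub3 a b c) b ≡ true
m3b a b c = trans (mem3 a b c b) (∨-introʳ (eqF a b) (∨-introˡ _ (eqF-refl b)))

m3c : ∀ {N} (a b c : Fin N) → lookup (sub3 a b c) c ≡ true
m3c a b c = trans (mem3 a b c c) (∨-introʳ (eqF a c) (∨-introʳ (eqF b c) (eqF-refl c)))

comp1 : ∀ {N} (G : Graph N) (a : Fin N) → components G (sub1 a) ≡ 1
comp1 G a = one-component G (sub1 a) a (m1a a) (conn-star G (sub1 a) a ca)
  where
  ca : ∀ u → lookup (sub1 a) u ≡ true → connected G (sub1 a) a u ≡ true
  ca u hu with eqF-true {a = a} {b = u} (trans (sym (mem1 a u)) hu)
  ... | refl = conn-refl G (sub1 a) a (m1a a)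

comp2 : ∀ {N} (G : Graph N) (a b : Fin N) → ¬ a ≡ b → (components G (sub2 a b) ≡ᵇ 1) ≡ adj G a b
comp2 G a b a≢b with adj G a b in eab
... | true = cong (_≡ᵇ 1) (one-component G X a (m2a a b) (conn-star G X a ca))
  where
  X : Subset _
  X = sub2 a b
  ca : ∀ u → lookup X u ≡ true → connected G X a u ≡ true
  ca u hu with in2 a b u (trans (sym (mem2 a b u)) hu)
  ... | inj₁ refl = conn-refl G X a (m2a a b)
  ... | inj₂ refl = conn-adj G X a b (m2a a b) (m2b a b) eab
... | false = ≡ᵇ-1 _ (iso-split G (sub2 a b) a b (m2a a b) (m2b a b) a≢b isol)
  where
  isol : ∀ v → lookup (sub2 a b) v ≡ true → adj G a v ≡ false
  isol v hv with in2 a b v (trans (sym (mem2 a b v)) hv)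
  ... | inj₁ refl = irrefl G a
  ... | inj₂ refl = eab

dist-ab : ∀ {N} {a b c : Fin N} → dist3 a b c ≡ true → ¬ a ≡ b
dist-ab {a = a} {b} {c} h e with a FP.≟ b
... | yes _ = t≢f h refl
... | no ne = ne e

dist-ac : ∀ {N} {a b c : Fin N} → dist3 a b c ≡ true → ¬ a ≡ c
dist-ac {a = a} {b} {c} h e with a FP.≟ b | a FP.≟ c
... | yes _ | _ = t≢f h refl
... | no _ | yes _ = t≢f h refl
... | no _ | no ne = ne e

dist-bc : ∀ {N} {a b c : Fin N} → dist3 a b c ≡ true → ¬ b ≡ c
dist-bc {a = a} {b} {c} h e with a FP.≟ b | a FP.≟ c | b FP.≟ c
... | yes _ | _ | _ = t≢f h refl
... | no _ | yes _ | _ = t≢f h refl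
... | no _ | no _ | yes _ = t≢f h refl
... | no _ | no _ | no ne = ne e

nonrep-bound : ∀ {N} (G : Graph N) (X : Subset N) (h : Fin N) → lookup X h ≡ true → isRep G X h ≡ false →
  components G X + 1 ≤ S N (λ v → ind (lookup X v))
nonrep-bound {N} G X h Xh nr = begin
  components G X + 1 ≡⟨ cong₂ _+_ (comp-S G X) (sym (S-single N h)) ⟩
  S N (λ v → ind (isRep G X v)) + S N (λ v → ind (eqF h v)) ≡⟨ sym (S-+ N _ _) ⟩
  S N (λ v → ind (isRep G X v) + ind (eqF h v)) ≤⟨ S-mono N pt ⟩
  S N (λ v → ind (lookup X v)) ∎
  where
  open ≤-Reasoning
  pt : ∀ v → ind (isRep G X v) + ind (eqF h v) ≤ ind (lookup X v)
  pt v with h FP.≟ v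
  ... | yes refl rewrite nr | Xh = ≤-refl
  ... | no _ with lookup X v in Xv
  ... | true = +-monoˡ-≤ 0 (ind≤1 _)
  ... | false = z≤n

module Triple {N} (G : Graph N) (a b c : Fin N) (d : dist3 a b c ≡ true) where
  X : Subset N
  X = sub3 a b c
  Xa : lookup X a ≡ true
  Xa = m3a a b c
  Xb : lookup X b ≡ true
  Xb = m3b a b c
  Xc : lookup X c ≡ true
  Xc = m3c a b c
  ab : ¬ a ≡ b
  ab = dist-ab {a = a} {b} {c} d

  inX : ∀ v → lookup X v ≡ true → v ≡ a ⊎ v ≡ b ⊎ v ≡ c
  inX v h = in3 a b c v (trans (sym (mem3 a b c v)) h)

  size : S N (λ v → ind (lookup X v)) ≡ 3
  size = trans (S-cong N (λ v → cong ind (mem3 a b c v)))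
               (S-triple N a b c ab (dist-ac {a = a} {b} {c} d) (dist-bc {a = a} {b} {c} d))

  isolA : adj G a b ≡ false → adj G a c ≡ false → ∀ v → lookup X v ≡ true → adj G a v ≡ false
  isolA ex ey v hv with inX v hv
  ... | inj₁ refl = irrefl G a
  ... | inj₂ (inj₁ refl) = ex
  ... | inj₂ (inj₂ refl) = ey

  isolB : adj G a b ≡ false → adj G b c ≡ false → ∀ v → lookup X v ≡ true → adj G b v ≡ false
  isolB ex ez v hv with inX v hv
  ... | inj₁ refl = trans (Graph.sym G b a) ex
  ... | inj₂ (inj₁ refl) = irrefl G b
  ... | inj₂ (inj₂ refl) = ez

  isolC : adj G a c ≡ false → adj G b c ≡ false → ∀ v → lookup X v ≡ true → adj G c v ≡ false
  isolC ey ez v hv with inX v hv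
  ... | inj₁ refl = trans (Graph.sym G c a) ey
  ... | inj₂ (inj₁ refl) = trans (Graph.sym G c b) ez
  ... | inj₂ (inj₂ refl) = irrefl G c

  connected-to-a : connected G X a b ≡ true → connected G X a c ≡ true → components G X ≡ 1
  connected-to-a hb hc = one-component G X a Xa (conn-star G X a ca)
    where
    ca : ∀ u → lookup X u ≡ true → connected G X a u ≡ true
    ca u hu with inX u hu
    ... | inj₁ refl = conn-refl G X a Xa
    ... | inj₂ (inj₁ refl) = hb
    ... | inj₂ (inj₂ refl) = hc

  edge : ∀ {p q} → lookup X p ≡ true → lookup X q ≡ true → adj G p q ≡ true → connected G X p q ≡ true
  edge hp hq e = conn-adj G X _ _ hp hq e

  isolated-not-one : ∀ z → lookup X z ≡ true → (∀ v → lookup X v ≡ true → adj G z v ≡ false) →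
    (components G X ≡ᵇ 1) ≡ false
  isolated-not-one z Xz isol with z FP.≟ a
  ... | no z≢a = ≡ᵇ-1 _ (iso-split G X z a Xz Xa z≢a isol)
  ... | yes refl = ≡ᵇ-1 _ (iso-split G X z b Xz Xb ab isol)

  one-comp : (components G X ≡ᵇ 1) ≡ ((adj G a b ∧ adj G a c) ∨ (adj G a b ∧ adj G b c) ∨ (adj G a c ∧ adj G b c))
  one-comp with adj G a b in ex | adj G a c in ey | adj G b c in ez
  ... | true | true | _ = cong (_≡ᵇ 1) (connected-to-a (edge Xa Xb ex) (edge Xa Xc ey))
  ... | true | false | true =
    cong (_≡ᵇ 1) (connected-to-a (edge Xa Xb ex) (conn-trans G X a b c (edge Xa Xb ex) (edge Xb Xc ez)))
  ... | false | true | true =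
    cong (_≡ᵇ 1) (connected-to-a (conn-trans G X a c b (edge Xa Xc ey) (conn-sym G X b c (edge Xb Xc ez))) (edge Xa Xc ey))
  ... | true | false | false = isolated-not-one c Xc (isolC ey ez)
  ... | false | true | false = isolated-not-one b Xb (isolB ex ez)
  ... | false | false | _ = isolated-not-one a Xa (isolA ex ey)

  below3 : components G X + 1 ≤ S N (λ v → ind (lookup X v)) → (components G X ≡ᵇ 3) ≡ false
  below3 le = eqb-false _ 3 (λ k≡3 → <-irrefl (sym size) (subst (λ k → k + 1 ≤ S N (λ v → ind (lookup X v))) k≡3 le))

  -- an edge inside X leaves a non-representative, so fewer than 3 components
  edge-not-three : ∀ p q → lookup X p ≡ true → lookup X q ≡ true → adj G p q ≡ true → (components G X ≡ᵇ 3) ≡ false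
  edge-not-three p q Xp Xq e with FP.<-cmp p q
  ... | tri< lt _ _ = below3 (nonrep-bound G X q Xq (nonrep G X p q Xp Xq lt e))
  ... | tri≈ _ eq _ = ⊥-elim (adj-irr G e eq)
  ... | tri> _ _ gt = below3 (nonrep-bound G X p Xp (nonrep G X q p Xq Xp gt (trans (Graph.sym G q p) e)))

  three-comp : (components G X ≡ᵇ 3) ≡ not (adj G a b ∨ adj G a c ∨ adj G b c)
  three-comp with adj G a b in ex | adj G a c in ey | adj G b c in ez
  ... | true | _ | _ = edge-not-three a b Xa Xb ex
  ... | false | true | _ = edge-not-three a c Xa Xc ey
  ... | false | false | true = edge-not-three b c Xb Xc ez
  ... | false | false | false = cong (_≡ᵇ 3) (trans (comp-S G X) (trans (S-cong N allRep) size))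
    where
    allRep : ∀ v → ind (isRep G X v) ≡ ind (lookup X v)
    allRep v with a FP.≟ v | b FP.≟ v | c FP.≟ v
    ... | yes refl | _ | _ = cong ind (trans (isol-rep G X a Xa (isolA ex ey)) (sym Xa))
    ... | no _ | yes refl | _ = cong ind (trans (isol-rep G X b Xb (isolB ex ez)) (sym Xb))
    ... | no _ | no _ | yes refl = cong ind (trans (isol-rep G X c Xc (isolC ey ez)) (sym Xc))
    ... | no na | no nb | no nc = cong ind (trans (∧-falseˡ Xvf) (sym Xvf))
      where
      Xvf : lookup X v ≡ false
      Xvf = trans (mem3 a b c v) (cong₂ _∨_ (eqF-false na) (cong₂ _∨_ (eqF-false nb) (eqF-false nc)))

-- The counting identities of the previous section turn
-- the coefficients of x y, x² y, x³ y and x³ y³ into sums over ordered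
-- vertex pairs and triples; reorganising those sums by a central vertex
-- yields the number of vertices, Σ deg and Σ deg².

T3 : ∀ N → (Fin N → Fin N → Fin N → ℕ) → ℕ
T3 N F = S N (λ a → S N (λ b → S N (λ c → F a b c)))

T3-cong : ∀ N {F G : Fin N → Fin N → Fin N → ℕ} → (∀ a b c → F a b c ≡ G a b c) → T3 N F ≡ T3 N G
T3-cong N h = S-cong N (λ a → S-cong N (λ b → S-cong N (λ c → h a b c)))

T3-+ : ∀ N (F G : Fin N → Fin N → Fin N → ℕ) → T3 N (λ a b c → F a b c + G a b c) ≡ T3 N F + T3 N G
T3-+ N F G = trans (S-cong N (λ a → trans (S-cong N (λ b → S-+ N (F a b) (G a b))) (S-+ N _ _))) (S-+ N _ _)

T3-* : ∀ N k (F : Fin N → Fin N → Fin N → ℕ) → T3 N (λ a b c → k * F a b c) ≡ k * T3 N F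
T3-* N k F = trans (S-cong N (λ a → trans (S-cong N (λ b → S-*ˡ N k (F a b))) (S-*ˡ N k _))) (S-*ˡ N k _)

swap12 : ∀ N (F : Fin N → Fin N → Fin N → ℕ) → T3 N F ≡ S N (λ b → S N (λ a → S N (λ c → F a b c)))
swap12 N F = ∑-comm (λ a b → S N (λ c → F a b c))

swap23 : ∀ N (F : Fin N → Fin N → Fin N → ℕ) → T3 N F ≡ S N (λ a → S N (λ c → S N (λ b → F a b c)))
swap23 N F = S-cong N (λ a → ∑-comm (λ b c → F a b c))

module DegreeSums {N : ℕ} (G : Graph N) where

  deg : Fin N → ℕ
  deg x = S N (λ y → ind (adj G x y))

  sdeg : ℕ
  sdeg = S N deg

  sdeg2 : ℕ
  sdeg2 = S N (λ x → deg x * deg x)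

  -- every vertex is a connected 1-set
  Q-order : Qcoeff G 1 1 ≡ N
  Q-order = trans (cnt1 N (λ X → components G X ≡ᵇ 1))
    (trans (S-cong N (λ a → cong (λ k → ind (k ≡ᵇ 1)) (comp1 G a))) (trans (S-const N 1) (*-identityʳ N)))

  -- the connected 2-sets are the edges
  Q-edges : 2 * Qcoeff G 2 1 ≡ sdeg
  Q-edges = trans (cnt2 N (λ X → components G X ≡ᵇ 1)) (S-cong N (λ a → S-cong N (λ b → pt a b)))
    where
    pt : ∀ a b → ind (not (eqF a b) ∧ (components G (sub2 a b) ≡ᵇ 1)) ≡ ind (adj G a b)
    pt a b with a FP.≟ b
    ... | yes refl = cong ind (sym (irrefl G a))
    ... | no ne = cong ind (comp2 G a b ne)

  third-vertex : ∀ (o p : Fin N) (F : Fin N → Bool) → (∀ r → F r ≡ (adj G o p ∧ not (eqF o r) ∧ not (eqF p r))) →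
    S N (λ r → ind (F r)) + 2 * ind (adj G o p) ≡ N * ind (adj G o p)
  third-vertex o p F h with adj G o p in eop
  ... | false = trans (+-identityʳ _) (trans (S-cong N (λ r → cong ind (h r))) (trans (S-zero N) (sym (*-zeroʳ N))))
  ... | true = begin
      S N (λ r → ind (F r)) + 2 ≡⟨ cong (S N (λ r → ind (F r)) +_) (sym (S-pair N o p (adj-irr G eop))) ⟩
      S N (λ r → ind (F r)) + S N (λ r → ind (eqF o r ∨ eqF p r)) ≡⟨ sym (S-+ N _ _) ⟩
      S N (λ r → ind (F r) + ind (eqF o r ∨ eqF p r)) ≡⟨ S-cong N pt ⟩
      S N (λ _ → 1) ≡⟨ S-const N 1 ⟩
      N * 1 ∎
    where
    open ≡-Reasoning
    pt : ∀ r → ind (F r) + ind (eqF o r ∨ eqF p r) ≡ 1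
    pt r rewrite h r with o FP.≟ r | p FP.≟ r
    ... | yes refl | yes refl = ⊥-elim (adj-irr G eop refl)
    ... | yes refl | no _ = refl
    ... | no _ | yes refl = refl
    ... | no _ | no _ = refl

  third-vertex-sum : ∀ (F : Fin N → Fin N → Fin N → Bool) → (∀ o p r → F o p r ≡ (adj G o p ∧ not (eqF o r) ∧ not (eqF p r))) →
    T3 N (λ o p r → ind (F o p r)) + 2 * sdeg ≡ N * sdeg
  third-vertex-sum F h = begin
    T3 N (λ o p r → ind (F o p r)) + 2 * sdeg ≡⟨ cong (T3 N (λ o p r → ind (F o p r)) +_) (sym (S-*ˡ N 2 deg)) ⟩
    T3 N (λ o p r → ind (F o p r)) + S N (λ o → 2 * deg o) ≡⟨ sym (S-+ N _ _) ⟩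
    S N (λ o → S N (λ p → S N (λ r → ind (F o p r))) + 2 * deg o) ≡⟨ S-cong N (λ o → cong (S N (λ p → S N (λ r → ind (F o p r))) +_) (sym (S-*ˡ N 2 _))) ⟩
    S N (λ o → S N (λ p → S N (λ r → ind (F o p r))) + S N (λ p → 2 * ind (adj G o p))) ≡⟨ S-cong N (λ o → sym (S-+ N _ _)) ⟩
    S N (λ o → S N (λ p → S N (λ r → ind (F o p r)) + 2 * ind (adj G o p))) ≡⟨ S-cong N (λ o → S-cong N (λ p → third-vertex o p (F o p) (h o p))) ⟩
    S N (λ o → S N (λ p → N * ind (adj G o p))) ≡⟨ S-cong N (λ o → S-*ˡ N N _) ⟩
    S N (λ o → N * deg o) ≡⟨ S-*ˡ N N deg ⟩
    N * sdeg ∎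
    where open ≡-Reasoning

  other-neighbour : ∀ (o p : Fin N) (F : Fin N → Bool) → (∀ r → F r ≡ (adj G o p ∧ adj G o r ∧ not (eqF p r))) →
    S N (λ r → ind (F r)) + ind (adj G o p) ≡ ind (adj G o p) * deg o
  other-neighbour o p F h with adj G o p in eop
  ... | false = trans (+-identityʳ _) (trans (S-cong N (λ r → cong ind (h r))) (S-zero N))
  ... | true = trans (cong (S N (λ r → ind (F r)) +_) (sym (S-single N p)))
                (trans (sym (S-+ N _ _)) (trans (S-cong N pt) (sym (+-identityʳ (deg o)))))
    where
    pt : ∀ r → ind (F r) + ind (eqF p r) ≡ ind (adj G o r)
    pt r rewrite h r with p FP.≟ r
    ... | yes refl rewrite eop = refl
    ... | no _ = trans (+-identityʳ _) (cong ind (∧-identityʳ _))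

  cherry-sum : ∀ (F : Fin N → Fin N → Fin N → Bool) → (∀ o p r → F o p r ≡ (adj G o p ∧ adj G o r ∧ not (eqF p r))) →
    T3 N (λ o p r → ind (F o p r)) + sdeg ≡ sdeg2
  cherry-sum F h = begin
    T3 N (λ o p r → ind (F o p r)) + sdeg ≡⟨ sym (S-+ N _ _) ⟩
    S N (λ o → S N (λ p → S N (λ r → ind (F o p r))) + S N (λ p → ind (adj G o p))) ≡⟨ S-cong N (λ o → sym (S-+ N _ _)) ⟩
    S N (λ o → S N (λ p → S N (λ r → ind (F o p r)) + ind (adj G o p))) ≡⟨ S-cong N (λ o → S-cong N (λ p → other-neighbour o p (F o p) (h o p))) ⟩
    S N (λ o → S N (λ p → ind (adj G o p) * deg o)) ≡⟨ S-cong N (λ o → S-*ʳ N _ (deg o)) ⟩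
    sdeg2 ∎
    where open ≡-Reasoning

  bA : ∀ x y z → (x ∧ y ∧ z) ≡ (x ∧ z ∧ y)
  bA true y z = ∧-comm y z
  bA false y z = refl

  bB : ∀ x y z → (x ∧ y ∧ z) ≡ (y ∧ x ∧ z)
  bB true true z = refl
  bB true false z = refl
  bB false true z = refl
  bB false false z = refl

  d-swap12 : ∀ (o p r : Fin N) → dist3 p o r ≡ dist3 o p r
  d-swap12 o p r = trans (cong (λ q → not q ∧ not (eqF p r) ∧ not (eqF o r)) (eqF-sym p o)) (bA (not (eqF o p)) (not (eqF p r)) (not (eqF o r)))

  d-swap23 : ∀ (o p r : Fin N) → dist3 o r p ≡ dist3 o p r
  d-swap23 o p r = trans (cong (λ q → not (eqF o r) ∧ not (eqF o p) ∧ not q) (eqF-sym r p)) (bB (not (eqF o r)) (not (eqF o p)) (not (eqF p r)))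

  nz : ∀ (o p r : Fin N) → (dist3 o p r ∧ adj G o p ∧ adj G o r) ≡ (adj G o p ∧ adj G o r ∧ not (eqF p r))
  nz o p r = lem (eqF o p) (eqF o r) (eqF p r) (adj G o p) (adj G o r) (λ e → adj-irr G e ∘ eqF-true) (λ e → adj-irr G e ∘ eqF-true)
    where
    lem : ∀ e1 e2 e3 x y → (x ≡ true → e1 ≡ true → ⊥) → (y ≡ true → e2 ≡ true → ⊥) →
      ((not e1 ∧ not e2 ∧ not e3) ∧ x ∧ y) ≡ (x ∧ y ∧ not e3)
    lem e1 e2 e3 false y h1 h2 = ∧-zeroʳ _
    lem e1 e2 e3 true false h1 h2 = ∧-zeroʳ _
    lem true e2 e3 true true h1 h2 = ⊥-elim (h1 refl refl)
    lem false true e3 true true h1 h2 = ⊥-elim (h2 refl refl)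
    lem false false e3 true true h1 h2 = ∧-identityʳ _

  nz2 : ∀ (o p r : Fin N) → (dist3 o p r ∧ adj G o p) ≡ (adj G o p ∧ not (eqF o r) ∧ not (eqF p r))
  nz2 o p r = lem (eqF o p) (eqF o r) (eqF p r) (adj G o p) (λ e → adj-irr G e ∘ eqF-true)
    where
    lem : ∀ e1 e2 e3 x → (x ≡ true → e1 ≡ true → ⊥) →
      ((not e1 ∧ not e2 ∧ not e3) ∧ x) ≡ (x ∧ not e2 ∧ not e3)
    lem e1 e2 e3 false h1 = ∧-zeroʳ _
    lem true e2 e3 true h1 = ⊥-elim (h1 refl refl)
    lem false e2 e3 true h1 = ∧-identityʳ _

  ge2 : Bool → Bool → Bool → Bool
  ge2 x y z = (x ∧ y) ∨ (x ∧ z) ∨ (y ∧ z)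

  -- The case analysis behind the triple identity: for three distinct
  -- vertices, cherries + [connected] + 2 = 2 · edges + 2 · [no edge].
  triple-cases : ∀ d x y z → ind (d ∧ x ∧ y) + ind (d ∧ x ∧ z) + ind (d ∧ y ∧ z) + ind (d ∧ ge2 x y z) + 2 * ind d
                   ≡ 2 * (ind (d ∧ x) + ind (d ∧ y) + ind (d ∧ z)) + 2 * ind (d ∧ not (x ∨ y ∨ z))
  triple-cases false x y z = refl
  triple-cases true true true true = refl
  triple-cases true true true false = refl
  triple-cases true true false true = refl
  triple-cases true true false false = refl
  triple-cases true false true true = refl
  triple-cases true false true false = refl
  triple-cases true false false true = refl
  triple-cases true false false false = refl

  condEq : ∀ d b1 b2 → (d ≡ true → b1 ≡ b2) → (d ∧ b1) ≡ (d ∧ b2)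
  condEq true b1 b2 h = h refl
  condEq false b1 b2 h = refl

  -- Indicators on ordered triples (a, b, c) of distinct vertices:
  -- Cᵢ the i-th kind of cherry (two edges), Eᵢ the i-th pair being an edge,
  -- Dg at least two edges (connected), Dz no edge, Dd no condition.
  C1 C2 C3 E1 E2 E3 Dg Dd Dz : Fin N → Fin N → Fin N → ℕ
  C1 a b c = ind (dist3 a b c ∧ adj G a b ∧ adj G a c)
  C2 a b c = ind (dist3 a b c ∧ adj G a b ∧ adj G b c)
  C3 a b c = ind (dist3 a b c ∧ adj G a c ∧ adj G b c)
  E1 a b c = ind (dist3 a b c ∧ adj G a b)
  E2 a b c = ind (dist3 a b c ∧ adj G a c)
  E3 a b c = ind (dist3 a b c ∧ adj G b c)
  Dg a b c = ind (dist3 a b c ∧ ge2 (adj G a b) (adj G a c) (adj G b c))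
  Dd a b c = ind (dist3 a b c)
  Dz a b c = ind (dist3 a b c ∧ not (adj G a b ∨ adj G a c ∨ adj G b c))

  Ctot Etot : ℕ
  Ctot = T3 N C1 + T3 N C2 + T3 N C3
  Etot = T3 N E1 + T3 N E2 + T3 N E3

  Q31 : 6 * Qcoeff G 3 1 ≡ T3 N Dg
  Q31 = trans (cnt3 N (λ X → components G X ≡ᵇ 1)) (T3-cong N λ a b c →
    cong ind (condEq (dist3 a b c) _ _ (λ d → Triple.one-comp G a b c d)))

  Q33 : 6 * Qcoeff G 3 3 ≡ T3 N Dz
  Q33 = trans (cnt3 N (λ X → components G X ≡ᵇ 3)) (T3-cong N λ a b c →
    cong ind (condEq (dist3 a b c) _ _ (λ d → Triple.three-comp G a b c d)))

  triple-identity : Ctot + 6 * Qcoeff G 3 1 + 2 * T3 N Dd ≡ 2 * Etot + 2 * (6 * Qcoeff G 3 3)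
  triple-identity = begin
    Ctot + 6 * Qcoeff G 3 1 + 2 * T3 N Dd ≡⟨ cong (λ z → Ctot + z + 2 * T3 N Dd) Q31 ⟩
    T3 N C1 + T3 N C2 + T3 N C3 + T3 N Dg + 2 * T3 N Dd ≡⟨ sym (cong₂ _+_ (trans (T3-+ N _ _) (cong₂ _+_ (trans (T3-+ N _ _) (cong₂ _+_ (T3-+ N _ _) refl)) refl)) (T3-* N 2 Dd)) ⟩
    T3 N (λ a b c → C1 a b c + C2 a b c + C3 a b c + Dg a b c) + T3 N (λ a b c → 2 * Dd a b c) ≡⟨ sym (T3-+ N _ _) ⟩
    T3 N (λ a b c → C1 a b c + C2 a b c + C3 a b c + Dg a b c + 2 * Dd a b c) ≡⟨ T3-cong N (λ a b c → triple-cases (dist3 a b c) (adj G a b) (adj G a c) (adj G b c)) ⟩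
    T3 N (λ a b c → 2 * (E1 a b c + E2 a b c + E3 a b c) + 2 * Dz a b c) ≡⟨ T3-+ N _ _ ⟩
    T3 N (λ a b c → 2 * (E1 a b c + E2 a b c + E3 a b c)) + T3 N (λ a b c → 2 * Dz a b c) ≡⟨ cong₂ _+_ (T3-* N 2 _) (T3-* N 2 _) ⟩
    2 * T3 N (λ a b c → E1 a b c + E2 a b c + E3 a b c) + 2 * T3 N Dz ≡⟨ cong₂ (λ x y → 2 * x + 2 * y) (trans (T3-+ N _ _) (cong₂ _+_ (T3-+ N _ _) refl)) (sym Q33) ⟩
    2 * Etot + 2 * (6 * Qcoeff G 3 3) ∎
    where open ≡-Reasoning

  cherry-total : Ctot + 3 * sdeg ≡ 3 * sdeg2
  cherry-total = begin
    T3 N C1 + T3 N C2 + T3 N C3 + 3 * sdeg ≡⟨ solve4 (T3 N C1) (T3 N C2) (T3 N C3) sdeg ⟩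
    (T3 N C1 + sdeg) + (T3 N C2 + sdeg) + (T3 N C3 + sdeg) ≡⟨ cong₂ _+_ (cong₂ _+_ c1 c2) c3 ⟩
    sdeg2 + sdeg2 + sdeg2 ≡⟨ solve1 sdeg2 ⟩
    3 * sdeg2 ∎
    where
    open ≡-Reasoning
    solve4 : ∀ a b c s → a + b + c + 3 * s ≡ (a + s) + (b + s) + (c + s)
    solve4 = solve-∀
    solve1 : ∀ s → s + s + s ≡ 3 * s
    solve1 = solve-∀
    c1 : T3 N C1 + sdeg ≡ sdeg2
    c1 = cherry-sum (λ a b c → dist3 a b c ∧ adj G a b ∧ adj G a c) nz
    c2 : T3 N C2 + sdeg ≡ sdeg2
    c2 = trans (cong (_+ sdeg) (swap12 N C2))
         (cherry-sum (λ o p r → dist3 p o r ∧ adj G p o ∧ adj G o r)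
           (λ o p r → trans (cong₂ (λ u v → u ∧ v ∧ adj G o r) (d-swap12 o p r) (Graph.sym G p o)) (nz o p r)))
    c3 : T3 N C3 + sdeg ≡ sdeg2
    c3 = trans (cong (_+ sdeg) (trans (swap23 N C3) (∑-comm (λ a c → S N (λ b → C3 a b c)))))
         (cherry-sum (λ o p r → dist3 p r o ∧ adj G p o ∧ adj G r o)
           (λ o p r → trans (cong₃ (d-swap' o p r) (Graph.sym G p o) (Graph.sym G r o)) (nz o p r)))
      where
      cong₃ : ∀ {a a' b b' c c'} → a ≡ a' → b ≡ b' → c ≡ c' → (a ∧ b ∧ c) ≡ (a' ∧ b' ∧ c')
      cong₃ refl refl refl = refl
      d-swap' : ∀ (o p r : Fin N) → dist3 p r o ≡ dist3 o p r
      d-swap' o p r = trans (d-swap23 p o r) (d-swap12 o p r)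

  edge-total : Etot + 6 * sdeg ≡ 3 * (N * sdeg)
  edge-total = begin
    T3 N E1 + T3 N E2 + T3 N E3 + 6 * sdeg ≡⟨ solve4 (T3 N E1) (T3 N E2) (T3 N E3) sdeg ⟩
    (T3 N E1 + 2 * sdeg) + (T3 N E2 + 2 * sdeg) + (T3 N E3 + 2 * sdeg) ≡⟨ cong₂ _+_ (cong₂ _+_ e1 e2) e3 ⟩
    N * sdeg + N * sdeg + N * sdeg ≡⟨ solve1 (N * sdeg) ⟩
    3 * (N * sdeg) ∎
    where
    open ≡-Reasoning
    solve4 : ∀ a b c s → a + b + c + 6 * s ≡ (a + 2 * s) + (b + 2 * s) + (c + 2 * s)
    solve4 = solve-∀
    solve1 : ∀ s → s + s + s ≡ 3 * s
    solve1 = solve-∀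
    e1 : T3 N E1 + 2 * sdeg ≡ N * sdeg
    e1 = third-vertex-sum (λ a b c → dist3 a b c ∧ adj G a b) nz2
    e2 : T3 N E2 + 2 * sdeg ≡ N * sdeg
    e2 = trans (cong (_+ 2 * sdeg) (swap23 N E2))
         (third-vertex-sum (λ o p r → dist3 o r p ∧ adj G o p) (λ o p r → trans (cong (_∧ adj G o p) (d-swap23 o p r)) (nz2 o p r)))
    e3 : T3 N E3 + 2 * sdeg ≡ N * sdeg
    e3 = trans (cong (_+ 2 * sdeg) (trans (swap12 N E3) (S-cong N (λ b → ∑-comm (λ a c → E3 a b c)))))
         (third-vertex-sum (λ o p r → dist3 r o p ∧ adj G o p) (λ o p r → trans (cong (_∧ adj G o p) (trans (d-swap12 o r p) (d-swap23 o p r))) (nz2 o p r)))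

Q-degree-sums : ∀ {N} (G G' : Graph N) → G ≡Q G' → (DegreeSums.sdeg G ≡ DegreeSums.sdeg G') × (DegreeSums.sdeg2 G ≡ DegreeSums.sdeg2 G')
Q-degree-sums {N} G G' eq = sd , sd2
  where
  module L = DegreeSums G
  module L' = DegreeSums G'
  sd : L.sdeg ≡ L'.sdeg
  sd = trans (sym L.Q-edges) (trans (cong (2 *_) (eq 2 1)) L'.Q-edges)
  et : L.Etot ≡ L'.Etot
  et = +-cancelʳ-≡ (6 * L.sdeg) _ _ (trans L.edge-total (trans (cong (λ s → 3 * (N * s)) sd) (trans (sym L'.edge-total) (cong (λ s → L'.Etot + 6 * s) (sym sd)))))
  ct : L.Ctot ≡ L'.Ctot
  ct = +-cancelʳ-≡ (6 * Qcoeff G 3 1 + 2 * T3 N L.Dd) _ _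
    (trans (sym (+-assoc L.Ctot _ _)) (trans L.triple-identity (trans (cong₂ (λ x y → 2 * x + 2 * (6 * y)) et (eq 3 3))
      (trans (sym L'.triple-identity) (trans (+-assoc L'.Ctot _ _) (cong (λ z → L'.Ctot + (6 * z + 2 * T3 N L.Dd)) (sym (eq 3 1))))))))
  sd2 : L.sdeg2 ≡ L'.sdeg2
  sd2 = *-cancelˡ-≡ L.sdeg2 L'.sdeg2 3 (trans (sym L.cherry-total) (trans (cong₂ (λ x y → x + 3 * y) ct sd) L'.cherry-total))


-- Degree sequences with Σ deg = 2N and Σ deg² = 4N + 2.  Then
-- Σ (deg - 2)² = Σ deg² - 4 Σ deg + 4N = 2, so exactly two vertices have
-- degree ≠ 2, each with |deg - 2| = 1; as Σ (deg - 2) = 0 one has degree 1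
-- and the other degree 3.

-- (d - 2)², defined by cases to stay in ℕ
sq2 : ℕ → ℕ
sq2 0 = 4
sq2 1 = 1
sq2 2 = 0
sq2 (suc (suc (suc k))) = suc k * suc k

sq2-eq : ∀ d → sq2 d + 4 * d ≡ d * d + 4
sq2-eq 0 = refl
sq2-eq 1 = refl
sq2-eq 2 = refl
sq2-eq (suc (suc (suc k))) = lem k
  where
  lem : ∀ k → suc k * suc k + 4 * suc (suc (suc k)) ≡ suc (suc (suc k)) * suc (suc (suc k)) + 4
  lem = solve-∀

sq2≢2 : ∀ d → ¬ sq2 d ≡ 2
sq2≢2 0 ()
sq2≢2 1 ()
sq2≢2 2 ()
sq2≢2 (suc (suc (suc zero))) ()
sq2≢2 (suc (suc (suc (suc k)))) e with m+n≡0⇒n≡0 k (suc-injective (suc-injective e))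
... | ()

sq2-1 : ∀ d → sq2 d ≡ 1 → d ≡ 1 ⊎ d ≡ 3
sq2-1 1 _ = inj₁ refl
sq2-1 3 _ = inj₂ refl
sq2-1 0 ()
sq2-1 2 ()
sq2-1 (suc (suc (suc (suc k)))) e with suc-injective e
... | ()

sq2-0 : ∀ d → sq2 d ≡ 0 → d ≡ 2
sq2-0 2 _ = refl
sq2-0 0 ()
sq2-0 1 ()
sq2-0 (suc (suc (suc k))) ()

S-zero-all : ∀ n (g : Fin n → ℕ) → S n g ≡ 0 → ∀ w → g w ≡ 0
S-zero-all (suc n) g e zero = m+n≡0⇒m≡0 (g zero) e
S-zero-all (suc n) g e (suc w) = S-zero-all n (g ∘ suc) (m+n≡0⇒n≡0 (g zero) e) w

one-one : ∀ n (g : Fin n → ℕ) → S n g ≡ 1 → Σ (Fin n) λ v → g v ≡ 1 × (∀ w → ¬ w ≡ v → g w ≡ 0)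
one-one (suc n) g e with g zero in e0
... | 0 with one-one n (g ∘ suc) e
... | v , gv , rest = suc v , gv , lem
  where
  lem : ∀ w → ¬ w ≡ suc v → g w ≡ 0
  lem zero _ = e0
  lem (suc w) ne = rest w (λ eq → ne (cong suc eq))
one-one (suc n) g e | 1 = zero , e0 , lem
  where
  lem : ∀ w → ¬ w ≡ zero → g w ≡ 0
  lem zero ne = ⊥-elim (ne refl)
  lem (suc w) _ = S-zero-all n (g ∘ suc) (suc-injective e) w
one-one (suc n) g e | suc (suc k) with e
... | ()

two-ones : ∀ n (g : Fin n → ℕ) → S n g ≡ 2 → (∀ v → ¬ g v ≡ 2) →
  Σ (Fin n) λ u → Σ (Fin n) λ v → ¬ u ≡ v × g u ≡ 1 × g v ≡ 1 × (∀ w → ¬ w ≡ u → ¬ w ≡ v → g w ≡ 0)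
two-ones (suc n) g e n2 with g zero in e0
... | 0 with two-ones n (g ∘ suc) e (n2 ∘ suc)
... | u , v , u≢v , gu , gv , rest = suc u , suc v , (λ eq → u≢v (FP.suc-injective eq)) , gu , gv , lem
  where
  lem : ∀ w → ¬ w ≡ suc u → ¬ w ≡ suc v → g w ≡ 0
  lem zero _ _ = e0
  lem (suc w) n1 n2' = rest w (λ eq → n1 (cong suc eq)) (λ eq → n2' (cong suc eq))
two-ones (suc n) g e n2 | 1 with one-one n (g ∘ suc) (suc-injective e)
... | v , gv , rest = zero , suc v , (λ ()) , e0 , gv , lem
  where
  lem : ∀ w → ¬ w ≡ zero → ¬ w ≡ suc v → g w ≡ 0
  lem zero ne _ = ⊥-elim (ne refl)
  lem (suc w) _ ne = rest w (λ eq → ne (cong suc eq))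
two-ones (suc n) g e n2 | 2 = ⊥-elim (n2 zero e0)
two-ones (suc n) g e n2 | suc (suc (suc k)) with e
... | ()

ssq-lem : ∀ N (f : Fin N → ℕ) → S N f ≡ 2 * N → S N (λ v → f v * f v) ≡ 4 * N + 2 → S N (sq2 ∘ f) ≡ 2
ssq-lem N f s1 s2 = +-cancelʳ-≡ (4 * S N f) _ _ (begin
  S N (sq2 ∘ f) + 4 * S N f ≡⟨ cong (S N (sq2 ∘ f) +_) (sym (S-*ˡ N 4 f)) ⟩
  S N (sq2 ∘ f) + S N (λ i → 4 * f i) ≡⟨ sym (S-+ N _ _) ⟩
  S N (λ i → sq2 (f i) + 4 * f i) ≡⟨ S-cong N (λ i → sq2-eq (f i)) ⟩
  S N (λ i → f i * f i + 4) ≡⟨ S-+ N _ _ ⟩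
  S N (λ i → f i * f i) + S N (λ _ → 4) ≡⟨ cong₂ _+_ s2 (S-const N 4) ⟩
  4 * N + 2 + N * 4 ≡⟨ ar N ⟩
  2 + 4 * (2 * N) ≡⟨ cong (λ z → 2 + 4 * z) (sym s1) ⟩
  2 + 4 * S N f ∎)
  where
  open ≡-Reasoning
  ar : ∀ N → 4 * N + 2 + N * 4 ≡ 2 + 4 * (2 * N)
  ar = solve-∀

two-exceptions-sum : ∀ N (f : Fin N → ℕ) (u v : Fin N) → ¬ u ≡ v →
  (∀ w → ¬ w ≡ u → ¬ w ≡ v → f w ≡ 2) → S N f + 4 ≡ 2 * N + (f u + f v)
two-exceptions-sum N f u v u≢v two = begin
  S N f + (2 * 1 + 2 * 1) ≡⟨ cong (λ z → S N f + (2 * z + 2 * 1)) (sym (S-single N u)) ⟩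
  S N f + (2 * S N (λ w → ind (eqF u w)) + 2 * 1) ≡⟨ cong (λ z → S N f + (2 * S N (λ w → ind (eqF u w)) + 2 * z)) (sym (S-single N v)) ⟩
  S N f + (2 * S N (λ w → ind (eqF u w)) + 2 * S N (λ w → ind (eqF v w))) ≡⟨ cong (λ z → S N f + z) (sym (cong₂ _+_ (S-*ˡ N 2 _) (S-*ˡ N 2 _))) ⟩
  S N f + (S N (λ w → 2 * ind (eqF u w)) + S N (λ w → 2 * ind (eqF v w))) ≡⟨ cong (S N f +_) (sym (S-+ N _ _)) ⟩
  S N f + S N (λ w → 2 * ind (eqF u w) + 2 * ind (eqF v w)) ≡⟨ sym (S-+ N _ _) ⟩
  S N (λ w → f w + (2 * ind (eqF u w) + 2 * ind (eqF v w))) ≡⟨ S-cong N pt ⟩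
  S N (λ w → 2 + (f u * ind (eqF u w) + f v * ind (eqF v w))) ≡⟨ S-+ N _ _ ⟩
  S N (λ _ → 2) + S N (λ w → f u * ind (eqF u w) + f v * ind (eqF v w)) ≡⟨ cong₂ _+_ (trans (S-const N 2) (*-comm N 2)) (S-+ N _ _) ⟩
  2 * N + (S N (λ w → f u * ind (eqF u w)) + S N (λ w → f v * ind (eqF v w))) ≡⟨ cong (λ z → 2 * N + z) (cong₂ _+_ (trans (S-*ˡ N (f u) _) (trans (cong (f u *_) (S-single N u)) (*-identityʳ (f u)))) (trans (S-*ˡ N (f v) _) (trans (cong (f v *_) (S-single N v)) (*-identityʳ (f v))))) ⟩
  2 * N + (f u + f v) ∎
  where
  open ≡-Reasoning
  pt : ∀ w → f w + (2 * ind (eqF u w) + 2 * ind (eqF v w)) ≡ 2 + (f u * ind (eqF u w) + f v * ind (eqF v w))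
  pt w with u FP.≟ w | v FP.≟ w
  ... | yes refl | yes refl = ⊥-elim (u≢v refl)
  ... | yes refl | no _ = trans (cong (f w +_) refl) (solveA (f w))
    where
    solveA : ∀ x → x + (2 * 1 + 2 * 0) ≡ 2 + (x * 1 + f v * 0)
    solveA x rewrite *-zeroʳ (f v) | *-identityʳ x = trans (+-comm x 2) (cong (2 +_) (sym (+-identityʳ x)))
  ... | no _ | yes refl = solveB (f w)
    where
    solveB : ∀ x → x + (2 * 0 + 2 * 1) ≡ 2 + (f u * 0 + x * 1)
    solveB x rewrite *-zeroʳ (f u) | *-identityʳ x = +-comm x 2
  ... | no a | no b rewrite *-zeroʳ (f u) | *-zeroʳ (f v) = trans (+-identityʳ (f w)) (two w (λ e → a (sym e)) (λ e → b (sym e)))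

record DegreeProfile {N : ℕ} (f : Fin N → ℕ) : Set where
  field
    leaf hub : Fin N
    leaf≢hub : ¬ leaf ≡ hub
    leaf-deg : f leaf ≡ 1
    hub-deg : f hub ≡ 3
    other-deg : ∀ v → ¬ v ≡ leaf → ¬ v ≡ hub → f v ≡ 2

degree-profile : ∀ N (f : Fin N → ℕ) → S N f ≡ 2 * N → S N (λ v → f v * f v) ≡ 4 * N + 2 → DegreeProfile f
degree-profile N f s1 s2 with two-ones N (sq2 ∘ f) (ssq-lem N f s1 s2) (λ v → sq2≢2 (f v))
... | u , v , u≢v , gu , gv , rest = fin (sq2-1 (f u) gu) (sq2-1 (f v) gv)
  where
  two : ∀ w → ¬ w ≡ u → ¬ w ≡ v → f w ≡ 2
  two w a b = sq2-0 (f w) (rest w a b)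
  sumuv : f u + f v ≡ 4
  sumuv = +-cancelˡ-≡ (2 * N) _ _ (sym (trans (cong (_+ 4) (sym s1)) (two-exceptions-sum N f u v u≢v two)))
  fin : f u ≡ 1 ⊎ f u ≡ 3 → f v ≡ 1 ⊎ f v ≡ 3 → DegreeProfile f
  fin (inj₁ a) (inj₂ b) = record { leaf = u ; hub = v ; leaf≢hub = u≢v ; leaf-deg = a ; hub-deg = b ; other-deg = two }
  fin (inj₂ a) (inj₁ b) = record { leaf = v ; hub = u ; leaf≢hub = λ e → u≢v (sym e) ; leaf-deg = b ; hub-deg = a
                                 ; other-deg = λ x p q → two x q p }
  fin (inj₁ a) (inj₁ b) with trans (sym (cong₂ _+_ a b)) sumuv
  ... | ()
  fin (inj₂ a) (inj₂ b) with trans (sym (cong₂ _+_ a b)) sumuv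
  ... | ()


sumR : ℕ → (ℕ → ℕ) → ℕ
sumR zero h = 0
sumR (suc N) h = sumR N h + h N

sumR-shift : ∀ N h → sumR (suc N) h ≡ h 0 + sumR N (h ∘ suc)
sumR-shift zero h = +-comm 0 (h 0)
sumR-shift (suc N) h = trans (cong (_+ h (suc N)) (sumR-shift N h)) (+-assoc (h 0) _ _)

S-toℕ : ∀ N h → S N (λ i → h (toℕ i)) ≡ sumR N h
S-toℕ zero h = refl
S-toℕ (suc N) h = trans (cong (h 0 +_) (S-toℕ N (h ∘ suc))) (sym (sumR-shift N h))

sumR-cong : ∀ N {h h' : ℕ → ℕ} → (∀ k → k < N → h k ≡ h' k) → sumR N h ≡ sumR N h'
sumR-cong zero e = refl
sumR-cong (suc N) e = cong₂ _+_ (sumR-cong N (λ k lt → e k (m≤n⇒m≤1+n lt))) (e N (n<1+n N))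

sumR-+ : ∀ N (h h' : ℕ → ℕ) → sumR N (λ k → h k + h' k) ≡ sumR N h + sumR N h'
sumR-+ zero h h' = refl
sumR-+ (suc N) h h' = trans (cong (_+ (h N + h' N)) (sumR-+ N h h')) (ar (sumR N h) (sumR N h') (h N) (h' N))
  where
  ar : ∀ a b c d → a + b + (c + d) ≡ a + c + (b + d)
  ar = solve-∀

sumR-*ˡ : ∀ N c (h : ℕ → ℕ) → sumR N (λ k → c * h k) ≡ c * sumR N h
sumR-*ˡ zero c h = sym (*-zeroʳ c)
sumR-*ˡ (suc N) c h = trans (cong (_+ c * h N) (sumR-*ˡ N c h)) (sym (*-distribˡ-+ c _ _))

sumR-zero : ∀ N → sumR N (λ _ → 0) ≡ 0
sumR-zero zero = refl
sumR-zero (suc N) = trans (+-identityʳ _) (sumR-zero N)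

sumR-const : ∀ N c → sumR N (λ _ → c) ≡ N * c
sumR-const zero c = refl
sumR-const (suc N) c = trans (cong (_+ c) (sumR-const N c)) (+-comm (N * c) c)

sumR-eq : ∀ N t → sumR N (λ k → ind (k ≡ᵇ t)) ≡ ind (t <ᵇ N)
sumR-eq zero t = refl
sumR-eq (suc N) t with <-cmp t N
... | tri< lt _ _ = trans (cong₂ _+_ (sumR-eq N t) (cong ind (eqb-false N t (λ e → <-irrefl (sym e) lt))))
                      (trans (cong (λ z → ind z + 0) (ltb-intro lt)) (cong ind (sym (ltb-intro (m≤n⇒m≤1+n lt)))))
... | tri≈ _ refl _ = trans (cong₂ _+_ (sumR-eq N t) (cong ind (eqb-refl t)))
                      (trans (cong (λ z → ind z + 1) (ltb-false t t (<-irrefl refl))) (cong ind (sym (ltb-intro (n<1+n t)))))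
... | tri> _ _ gt = trans (cong₂ _+_ (sumR-eq N t) (cong ind (eqb-false N t (λ e → <-irrefl e gt))))
                      (trans (cong (λ z → ind z + 0) (ltb-false t N (<⇒≱ gt ∘ <⇒≤))) (cong ind (sym (ltb-false t (suc N) (λ lt → <⇒≱ gt (s≤s⁻¹ lt))))))

sumR-eq' : ∀ N t → sumR N (λ k → ind (t ≡ᵇ k)) ≡ ind (t <ᵇ N)
sumR-eq' N t = trans (sumR-cong N (λ k _ → cong ind (eqb-sym t k))) (sumR-eq N t)

-- Path-with-chord graphs.  chordAdj N p describes the graph on 0, …, N-1
-- with path edges i — i+1 and the chord p — (N-1).  For 1 ≤ p ≤ N-3 this
-- is the tadpole T_{p, N-p}: the path 0 … p-1 hangs off the cycle p … N-1.

chordAdj : ℕ → ℕ → ℕ → ℕ → Bool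
chordAdj N p a b = (b ≡ᵇ suc a) ∨ (a ≡ᵇ suc b) ∨ ((a ≡ᵇ p) ∧ (b ≡ᵇ N ∸ 1)) ∨ ((b ≡ᵇ p) ∧ (a ≡ᵇ N ∸ 1))

chordAdj-sym : ∀ N p a b → chordAdj N p a b ≡ chordAdj N p b a
chordAdj-sym N p a b = lem (b ≡ᵇ suc a) (a ≡ᵇ suc b) ((a ≡ᵇ p) ∧ (b ≡ᵇ N ∸ 1)) ((b ≡ᵇ p) ∧ (a ≡ᵇ N ∸ 1))
  where
  lem : ∀ x y z w → (x ∨ y ∨ z ∨ w) ≡ (y ∨ x ∨ w ∨ z)
  lem true true z w = refl
  lem true false z w = refl
  lem false true z w = refl
  lem false false true true = refl
  lem false false true false = refl
  lem false false false true = refl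
  lem false false false false = refl

chordAdj-elim : ∀ N p a b → chordAdj N p a b ≡ true →
  (b ≡ suc a) ⊎ (a ≡ suc b) ⊎ (a ≡ p × b ≡ N ∸ 1) ⊎ (b ≡ p × a ≡ N ∸ 1)
chordAdj-elim N p a b e with ∨-true (b ≡ᵇ suc a) _ e
... | inj₁ h = inj₁ (eqb-true b (suc a) h)
... | inj₂ h with ∨-true (a ≡ᵇ suc b) _ h
... | inj₁ h' = inj₂ (inj₁ (eqb-true a (suc b) h'))
... | inj₂ h' with ∨-true ((a ≡ᵇ p) ∧ (b ≡ᵇ N ∸ 1)) _ h'
... | inj₁ h'' = inj₂ (inj₂ (inj₁ (eqb-true a p (proj₁ (∧-true _ _ h'')) , eqb-true b (N ∸ 1) (proj₂ (∧-true _ _ h'')))))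
... | inj₂ h'' = inj₂ (inj₂ (inj₂ (eqb-true b p (proj₁ (∧-true _ _ h'')) , eqb-true a (N ∸ 1) (proj₂ (∧-true _ _ h'')))))

chordAdj-i1 : ∀ N p a b → b ≡ suc a → chordAdj N p a b ≡ true
chordAdj-i1 N p a b e = ∨-introˡ _ (eqb-intro e)
chordAdj-i2 : ∀ N p a b → a ≡ suc b → chordAdj N p a b ≡ true
chordAdj-i2 N p a b e = ∨-introʳ (b ≡ᵇ suc a) (∨-introˡ _ (eqb-intro e))
chordAdj-i3 : ∀ N p a b → a ≡ p → b ≡ N ∸ 1 → chordAdj N p a b ≡ true
chordAdj-i3 N p a b e1 e2 = ∨-introʳ (b ≡ᵇ suc a) (∨-introʳ (a ≡ᵇ suc b) (∨-introˡ _ (∧-intro (eqb-intro e1) (eqb-intro e2))))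
chordAdj-i4 : ∀ N p a b → b ≡ p → a ≡ N ∸ 1 → chordAdj N p a b ≡ true
chordAdj-i4 N p a b e1 e2 = ∨-introʳ (b ≡ᵇ suc a) (∨-introʳ (a ≡ᵇ suc b) (∨-introʳ ((a ≡ᵇ p) ∧ (b ≡ᵇ N ∸ 1)) (∧-intro (eqb-intro e1) (eqb-intro e2))))

lt-pred : ∀ N → 1 ≤ N → N ∸ 1 < N
lt-pred (suc N) _ = n<1+n N

record Labelling {N : ℕ} (G : Graph N) (p : ℕ) : Set where
  field
    g : Fin N → Fin N
    gi : Fin N → Fin N
    g-gi : ∀ v → g (gi v) ≡ v
    gi-g : ∀ i → gi (g i) ≡ i
    p≥1 : 1 ≤ p
    p+3 : p + 3 ≤ N
    adjg : ∀ i j → adj G (g i) (g j) ≡ chordAdj N p (toℕ i) (toℕ j)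

-- The tadpole of Defs is, with the identity labelling, the path with
-- chord m (the bridge (m-1) — m is the path edge into the cycle).
module TadpoleIsChord (m n : ℕ) (m≥1 : 1 ≤ m) (n≥3 : 3 ≤ n) where
  N : ℕ
  N = m + n

  E : ℕ → ℕ → Bool
  E = tadEdge m n

  E-chordAdj : ∀ a b → E a b ≡ true → chordAdj N m a b ≡ true
  E-chordAdj a b e with ∨-true ((b ≡ᵇ suc a) ∧ (b <ᵇ m)) _ e
  ... | inj₁ h = chordAdj-i1 N m a b (eqb-true b (suc a) (proj₁ (∧-true _ _ h)))
  ... | inj₂ h with ∨-true ((a ≡ᵇ m ∸ 1) ∧ (b ≡ᵇ m)) _ h
  ... | inj₁ h' = chordAdj-i1 N m a b (trans (eqb-true b m (proj₂ (∧-true _ _ h')))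
                     (trans (sym (m∸n+n≡m m≥1)) (trans (+-comm (m ∸ 1) 1) (cong suc (sym (eqb-true a (m ∸ 1) (proj₁ (∧-true _ _ h'))))))))
  ... | inj₂ h' with ∧-true (m ≤ᵇ a) _ h'
  ... | _ , h2 with ∧-true (b <ᵇ m + n) _ h2
  ... | _ , h3 with ∨-true (b ≡ᵇ suc a) _ h3
  ... | inj₁ h4 = chordAdj-i1 N m a b (eqb-true b (suc a) h4)
  ... | inj₂ h4 = chordAdj-i3 N m a b (eqb-true a m (proj₁ (∧-true _ _ h4))) (eqb-true b (m + n ∸ 1) (proj₂ (∧-true _ _ h4)))

  N-1 : N ∸ 1 ≡ m + (n ∸ 1)
  N-1 = +-∸-assoc m {n} {1} (≤-trans (s≤s z≤n) n≥3)

  succE : ∀ a b → b < N → b ≡ suc a → E a b ≡ true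
  succE a b bN e with b <? m
  ... | yes b<m = ∨-introˡ _ (∧-intro (eqb-intro e) (ltb-intro b<m))
  ... | no b≮m with b ≟ m
  ... | yes b≡m = ∨-introʳ ((b ≡ᵇ suc a) ∧ (b <ᵇ m)) (∨-introˡ _ (∧-intro (eqb-intro a≡) (eqb-intro b≡m)))
    where
    a≡ : a ≡ m ∸ 1
    a≡ = trans (sym (cong (_∸ 1) e)) (cong (_∸ 1) b≡m)
  ... | no b≢m = ∨-introʳ ((b ≡ᵇ suc a) ∧ (b <ᵇ m)) (∨-introʳ ((a ≡ᵇ m ∸ 1) ∧ (b ≡ᵇ m))
      (∧-intro (leb-intro m≤a) (∧-intro (ltb-intro bN) (∨-introˡ _ (eqb-intro e)))))
    where
    m≤a : m ≤ a
    m≤a = s≤s⁻¹ (subst (suc m ≤_) e (≤∧≢⇒< (≮⇒≥ b≮m) (λ q → b≢m (sym q))))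

  chordE : ∀ a b → a ≡ m → b ≡ N ∸ 1 → E a b ≡ true
  chordE a b e1 e2 = ∨-introʳ ((b ≡ᵇ suc a) ∧ (b <ᵇ m)) (∨-introʳ ((a ≡ᵇ m ∸ 1) ∧ (b ≡ᵇ m))
      (∧-intro (leb-intro (≤-reflexive (sym e1))) (∧-intro (ltb-intro bN) (∨-introʳ (b ≡ᵇ suc a) (∧-intro (eqb-intro e1) (eqb-intro e2))))))
    where
    bN : b < m + n
    bN = subst (_< m + n) (sym e2) (lt-pred (m + n) (≤-trans m≥1 (m≤m+n m n)))

  m≢N-1 : ¬ m ≡ N ∸ 1
  m≢N-1 e = <-irrefl e (subst (m <_) (sym N-1) (m<m+n m (≤-trans (s≤s z≤n) (∸-monoˡ-≤ 1 n≥3))))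

  tadpole-chordAdj : ∀ (u v : Fin N) → tadAdj m n u v ≡ chordAdj N m (toℕ u) (toℕ v)
  tadpole-chordAdj u v = boolEq fwd bwd
    where
    a b : ℕ
    a = toℕ u
    b = toℕ v
    aN : a < N
    aN = FP.toℕ<n u
    bN : b < N
    bN = FP.toℕ<n v
    fwd : tadAdj m n u v ≡ true → chordAdj N m a b ≡ true
    fwd e with ∨-true (E a b) (E b a) (proj₂ (∧-true _ _ e))
    ... | inj₁ h = E-chordAdj a b h
    ... | inj₂ h = trans (chordAdj-sym N m a b) (E-chordAdj b a h)
    neq : ¬ a ≡ b → not (a ≡ᵇ b) ≡ true
    neq ne = not-false (eqb-false a b ne)
    bwd : chordAdj N m a b ≡ true → tadAdj m n u v ≡ true
    bwd e with chordAdj-elim N m a b e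
    ... | inj₁ e1 = ∧-intro (neq (λ q → 1+n≢n (sym (trans q e1)))) (∨-introˡ _ (succE a b bN e1))
    ... | inj₂ (inj₁ e1) = ∧-intro (neq (λ q → 1+n≢n (sym (trans (sym q) e1)))) (∨-introʳ (E a b) (succE b a aN e1))
    ... | inj₂ (inj₂ (inj₁ (e1 , e2))) = ∧-intro (neq (λ q → m≢N-1 (trans (sym e1) (trans q e2)))) (∨-introˡ _ (chordE a b e1 e2))
    ... | inj₂ (inj₂ (inj₂ (e1 , e2))) = ∧-intro (neq (λ q → m≢N-1 (trans (sym e1) (trans (sym q) e2)))) (∨-introʳ (E a b) (chordE b a e1 e2))

tadpole-labelling : ∀ m n → 1 ≤ m → 3 ≤ n → Labelling (tadpole m n) m
tadpole-labelling m n m≥1 n≥3 = record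
  { g = id ; gi = id ; g-gi = λ _ → refl ; gi-g = λ _ → refl
  ; p≥1 = m≥1 ; p+3 = +-monoʳ-≤ m n≥3
  ; adjg = TadpoleIsChord.tadpole-chordAdj m n m≥1 n≥3 }

chordDeg : ℕ → ℕ → ℕ → ℕ
chordDeg N p a = ind (suc a <ᵇ N) + ind (0 <ᵇ a) + ind (a ≡ᵇ p) + ind (a ≡ᵇ N ∸ 1)

ind-disjoint4 : ∀ x y z1 z2 w1 w2 →
  (x ≡ true → y ≡ true → ⊥) → (x ≡ true → (z1 ∧ z2) ≡ true → ⊥) → (x ≡ true → (w1 ∧ w2) ≡ true → ⊥) →
  (y ≡ true → (z1 ∧ z2) ≡ true → ⊥) → (y ≡ true → (w1 ∧ w2) ≡ true → ⊥) → ((z1 ∧ z2) ≡ true → (w1 ∧ w2) ≡ true → ⊥) →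
  ind (x ∨ y ∨ (z1 ∧ z2) ∨ (w1 ∧ w2)) ≡ ind x + ind y + ind z1 * ind z2 + ind w1 * ind w2
ind-disjoint4 true true _ _ _ _ h _ _ _ _ _ = ⊥-elim (h refl refl)
ind-disjoint4 true false true true _ _ _ h _ _ _ _ = ⊥-elim (h refl refl)
ind-disjoint4 true false _ _ true true _ _ h _ _ _ = ⊥-elim (h refl refl)
ind-disjoint4 false true true true _ _ _ _ _ h _ _ = ⊥-elim (h refl refl)
ind-disjoint4 false true _ _ true true _ _ _ _ h _ = ⊥-elim (h refl refl)
ind-disjoint4 false false true true true true _ _ _ _ _ h = ⊥-elim (h refl refl)
ind-disjoint4 true false true false true false _ _ _ _ _ _ = refl
ind-disjoint4 true false true false false w2 _ _ _ _ _ _ = refl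
ind-disjoint4 true false false z2 true false _ _ _ _ _ _ = refl
ind-disjoint4 true false false z2 false w2 _ _ _ _ _ _ = refl
ind-disjoint4 false true true false true false _ _ _ _ _ _ = refl
ind-disjoint4 false true true false false w2 _ _ _ _ _ _ = refl
ind-disjoint4 false true false z2 true false _ _ _ _ _ _ = refl
ind-disjoint4 false true false z2 false w2 _ _ _ _ _ _ = refl
ind-disjoint4 false false true true true false _ _ _ _ _ _ = refl
ind-disjoint4 false false true true false w2 _ _ _ _ _ _ = refl
ind-disjoint4 false false true false true true _ _ _ _ _ _ = refl
ind-disjoint4 false false false z2 true true _ _ _ _ _ _ = refl
ind-disjoint4 false false true false true false _ _ _ _ _ _ = refl
ind-disjoint4 false false true false false w2 _ _ _ _ _ _ = refl
ind-disjoint4 false false false z2 true false _ _ _ _ _ _ = refl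
ind-disjoint4 false false false z2 false w2 _ _ _ _ _ _ = refl

module ChordDegrees (N p : ℕ) (p≥1 : 1 ≤ p) (p+3 : p + 3 ≤ N) where

  N≥1 : 1 ≤ N
  N≥1 = ≤-trans (s≤s z≤n) (≤-trans (m≤n+m 3 p) p+3)

  sN : suc (N ∸ 1) ≡ N
  sN = trans (+-comm 1 (N ∸ 1)) (m∸n+n≡m N≥1)

  p<N-2 : suc (suc p) < N
  p<N-2 = subst (_≤ N) (+-comm p 3) p+3

  -- the four kinds of edges at a are mutually exclusive
  chordAdj-split : ∀ a k → ind (chordAdj N p a k) ≡ ind (k ≡ᵇ suc a) + ind (a ≡ᵇ suc k) + ind (a ≡ᵇ p) * ind (k ≡ᵇ N ∸ 1) + ind (k ≡ᵇ p) * ind (a ≡ᵇ N ∸ 1)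
  chordAdj-split a k = ind-disjoint4 (k ≡ᵇ suc a) (a ≡ᵇ suc k) (a ≡ᵇ p) (k ≡ᵇ N ∸ 1) (k ≡ᵇ p) (a ≡ᵇ N ∸ 1) xy xz xw yz yw zw
    where
    E : ∀ x y → (x ≡ᵇ y) ≡ true → x ≡ y
    E = eqb-true
    pr : ∀ {u v} → (u ∧ v) ≡ true → u ≡ true × v ≡ true
    pr {u} {v} = ∧-true u v
    c-pN : ¬ p ≡ N
    c-pN e = <-irrefl e (<-trans (n<1+n p) (<-trans (n<1+n (suc p)) p<N-2))
    c-pN1 : ¬ p ≡ N ∸ 1
    c-pN1 e = <-irrefl (trans (cong suc e) sN) (<-trans (n<1+n (suc p)) p<N-2)
    c-pN2 : ¬ suc p ≡ N ∸ 1
    c-pN2 e = <-irrefl (trans (cong suc e) sN) p<N-2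
    xy : (k ≡ᵇ suc a) ≡ true → (a ≡ᵇ suc k) ≡ true → ⊥
    xy h1 h2 = <-irrefl (trans (E a (suc k) h2) (cong suc (E k (suc a) h1))) (m≤n⇒m≤1+n (n<1+n a))
    xz : (k ≡ᵇ suc a) ≡ true → ((a ≡ᵇ p) ∧ (k ≡ᵇ N ∸ 1)) ≡ true → ⊥
    xz h1 h2 = c-pN2 (trans (cong suc (sym (E a p (proj₁ (pr h2))))) (trans (sym (E k (suc a) h1)) (E k (N ∸ 1) (proj₂ (pr h2)))))
    xw : (k ≡ᵇ suc a) ≡ true → ((k ≡ᵇ p) ∧ (a ≡ᵇ N ∸ 1)) ≡ true → ⊥
    xw h1 h2 = c-pN (trans (sym (E k p (proj₁ (pr h2)))) (trans (E k (suc a) h1) (trans (cong suc (E a (N ∸ 1) (proj₂ (pr h2)))) sN)))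
    yz : (a ≡ᵇ suc k) ≡ true → ((a ≡ᵇ p) ∧ (k ≡ᵇ N ∸ 1)) ≡ true → ⊥
    yz h1 h2 = c-pN (trans (sym (E a p (proj₁ (pr h2)))) (trans (E a (suc k) h1) (trans (cong suc (E k (N ∸ 1) (proj₂ (pr h2)))) sN)))
    yw : (a ≡ᵇ suc k) ≡ true → ((k ≡ᵇ p) ∧ (a ≡ᵇ N ∸ 1)) ≡ true → ⊥
    yw h1 h2 = c-pN2 (trans (cong suc (sym (E k p (proj₁ (pr h2))))) (trans (sym (E a (suc k) h1)) (E a (N ∸ 1) (proj₂ (pr h2)))))
    zw : ((a ≡ᵇ p) ∧ (k ≡ᵇ N ∸ 1)) ≡ true → ((k ≡ᵇ p) ∧ (a ≡ᵇ N ∸ 1)) ≡ true → ⊥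
    zw h1 h2 = c-pN1 (trans (sym (E k p (proj₁ (pr h2)))) (E k (N ∸ 1) (proj₂ (pr h1))))

  predecessor-count : ∀ a → a < N → sumR N (λ k → ind (a ≡ᵇ suc k)) ≡ ind (0 <ᵇ a)
  predecessor-count zero _ = sumR-zero N
  predecessor-count (suc a) lt = trans (sumR-eq' N a) (cong ind (ltb-intro (<-trans (n<1+n a) lt)))

  chordAdj-degree : ∀ a → a < N → sumR N (λ k → ind (chordAdj N p a k)) ≡ chordDeg N p a
  chordAdj-degree a lt = begin
    sumR N (λ k → ind (chordAdj N p a k)) ≡⟨ sumR-cong N (λ k _ → chordAdj-split a k) ⟩
    sumR N (λ k → ind (k ≡ᵇ suc a) + ind (a ≡ᵇ suc k) + ind (a ≡ᵇ p) * ind (k ≡ᵇ N ∸ 1) + ind (k ≡ᵇ p) * ind (a ≡ᵇ N ∸ 1))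
      ≡⟨ trans (sumR-+ N _ _) (cong₂ _+_ (trans (sumR-+ N _ _) (cong₂ _+_ (sumR-+ N _ _) refl)) refl) ⟩
    sumR N (λ k → ind (k ≡ᵇ suc a)) + sumR N (λ k → ind (a ≡ᵇ suc k)) + sumR N (λ k → ind (a ≡ᵇ p) * ind (k ≡ᵇ N ∸ 1)) + sumR N (λ k → ind (k ≡ᵇ p) * ind (a ≡ᵇ N ∸ 1))
      ≡⟨ cong₂ _+_ (cong₂ _+_ (cong₂ _+_ (sumR-eq N (suc a)) (predecessor-count a lt)) (trans (sumR-*ˡ N (ind (a ≡ᵇ p)) (λ k → ind (k ≡ᵇ N ∸ 1))) (cong (ind (a ≡ᵇ p) *_) (trans (sumR-eq N (N ∸ 1)) (cong ind (ltb-intro (lt-pred N N≥1)))))))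
           (trans (sumR-cong N (λ k _ → *-comm (ind (k ≡ᵇ p)) (ind (a ≡ᵇ N ∸ 1)))) (trans (sumR-*ˡ N (ind (a ≡ᵇ N ∸ 1)) (λ k → ind (k ≡ᵇ p))) (cong (ind (a ≡ᵇ N ∸ 1) *_) (trans (sumR-eq N p) (cong ind (ltb-intro (<-trans (n<1+n p) (<-trans (n<1+n (suc p)) p<N-2)))))))) ⟩
    ind (suc a <ᵇ N) + ind (0 <ᵇ a) + ind (a ≡ᵇ p) * 1 + ind (a ≡ᵇ N ∸ 1) * 1
      ≡⟨ cong₂ _+_ (cong₂ _+_ refl (*-identityʳ (ind (a ≡ᵇ p)))) (*-identityʳ (ind (a ≡ᵇ N ∸ 1))) ⟩
    chordDeg N p a ∎
    where open ≡-Reasoning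

  cong4 : ∀ {a a' b b' c c' d d'} → a ≡ a' → b ≡ b' → c ≡ c' → d ≡ d' → ind a + ind b + ind c + ind d ≡ ind a' + ind b' + ind c' + ind d'
  cong4 refl refl refl refl = refl

  chordDeg-cases : ∀ a → a < N → (a ≡ 0 × chordDeg N p a ≡ 1) ⊎ (a ≡ p × chordDeg N p a ≡ 3) ⊎ (¬ a ≡ 0 × ¬ a ≡ p × chordDeg N p a ≡ 2)
  chordDeg-cases a lt with a ≟ 0 | a ≟ p | a ≟ N ∸ 1
  ... | yes refl | _ | _ = inj₁ (refl , cong4 (ltb-intro (≤-trans (s≤s (s≤s z≤n)) (≤-trans (m≤n+m 3 p) p+3)))
                                         refl (eqb-false 0 p (λ e → <-irrefl e p≥1)) (eqb-false 0 (N ∸ 1) (λ e → <-irrefl e N-1≥1)))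
    where
    N-1≥1 : 0 < N ∸ 1
    N-1≥1 = ≤-trans (s≤s z≤n) (∸-monoˡ-≤ 1 (≤-trans (s≤s (s≤s z≤n)) (≤-trans (m≤n+m 3 p) p+3)))
  ... | no a≢0 | yes refl | _ = inj₂ (inj₁ (refl , cong4 (ltb-intro (<-trans (n<1+n (suc p)) p<N-2)) (ltb-intro p≥1) (eqb-refl p)
                                         (eqb-false p (N ∸ 1) (λ e → <-irrefl (trans (cong suc e) sN) (<-trans (n<1+n (suc p)) p<N-2)))))
  ... | no a≢0 | no a≢p | yes refl = inj₂ (inj₂ (a≢0 , a≢p , cong4 (ltb-false (suc (N ∸ 1)) N (λ h → <-irrefl sN h)) (ltb-intro (1≤-≢0 a≢0)) (eqb-false _ p a≢p) (eqb-refl (N ∸ 1))))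
  ... | no a≢0 | no a≢p | no a≢N = inj₂ (inj₂ (a≢0 , a≢p , cong4 (ltb-intro sa<N) (ltb-intro (1≤-≢0 a≢0)) (eqb-false a p a≢p) (eqb-false a (N ∸ 1) a≢N)))
    where
    sa<N : suc a < N
    sa<N = ≤∧≢⇒< lt (λ e → a≢N (cong (_∸ 1) e))

  chordDeg-linear : ∀ a → a < N → chordDeg N p a + ind (a ≡ᵇ 0) ≡ 2 + ind (a ≡ᵇ p)
  chordDeg-linear a lt with chordDeg-cases a lt
  ... | inj₁ (refl , e) rewrite e | eqb-false 0 p (λ q → <-irrefl q p≥1) = refl
  ... | inj₂ (inj₁ (refl , e)) rewrite e | eqb-refl p | eqb-false p 0 (λ q → <-irrefl (sym q) p≥1) = refl
  ... | inj₂ (inj₂ (n0 , np , e)) rewrite e | eqb-false a 0 n0 | eqb-false a p np = refl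

  chordDeg-square : ∀ a → a < N → chordDeg N p a * chordDeg N p a + 3 * ind (a ≡ᵇ 0) ≡ 4 + 5 * ind (a ≡ᵇ p)
  chordDeg-square a lt with chordDeg-cases a lt
  ... | inj₁ (refl , e) rewrite e | eqb-false 0 p (λ q → <-irrefl q p≥1) = refl
  ... | inj₂ (inj₁ (refl , e)) rewrite e | eqb-refl p | eqb-false p 0 (λ q → <-irrefl (sym q) p≥1) = refl
  ... | inj₂ (inj₂ (n0 , np , e)) rewrite e | eqb-false a 0 n0 | eqb-false a p np = refl

  count-zero : sumR N (λ a → ind (a ≡ᵇ 0)) ≡ 1
  count-zero = trans (sumR-eq N 0) (cong ind (ltb-intro N≥1))
  count-p : sumR N (λ a → ind (a ≡ᵇ p)) ≡ 1
  count-p = trans (sumR-eq N p) (cong ind (ltb-intro (<-trans (n<1+n p) (<-trans (n<1+n (suc p)) p<N-2))))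

  chordDeg-sum : sumR N (chordDeg N p) ≡ 2 * N
  chordDeg-sum = +-cancelʳ-≡ 1 _ _ (begin
    sumR N (chordDeg N p) + 1 ≡⟨ cong (sumR N (chordDeg N p) +_) (sym count-zero) ⟩
    sumR N (chordDeg N p) + sumR N (λ a → ind (a ≡ᵇ 0)) ≡⟨ sym (sumR-+ N _ _) ⟩
    sumR N (λ a → chordDeg N p a + ind (a ≡ᵇ 0)) ≡⟨ sumR-cong N chordDeg-linear ⟩
    sumR N (λ a → 2 + ind (a ≡ᵇ p)) ≡⟨ sumR-+ N _ _ ⟩
    sumR N (λ _ → 2) + sumR N (λ a → ind (a ≡ᵇ p)) ≡⟨ cong₂ _+_ (trans (sumR-const N 2) (*-comm N 2)) count-p ⟩
    2 * N + 1 ∎)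
    where open ≡-Reasoning

  chordDeg-square-sum : sumR N (λ a → chordDeg N p a * chordDeg N p a) ≡ 4 * N + 2
  chordDeg-square-sum = +-cancelʳ-≡ 3 _ _ (begin
    sumR N (λ a → chordDeg N p a * chordDeg N p a) + 3 ≡⟨ cong (λ z → sumR N (λ a → chordDeg N p a * chordDeg N p a) + 3 * z) (sym count-zero) ⟩
    sumR N (λ a → chordDeg N p a * chordDeg N p a) + 3 * sumR N (λ a → ind (a ≡ᵇ 0)) ≡⟨ cong (sumR N (λ a → chordDeg N p a * chordDeg N p a) +_) (sym (sumR-*ˡ N 3 _)) ⟩
    sumR N (λ a → chordDeg N p a * chordDeg N p a) + sumR N (λ a → 3 * ind (a ≡ᵇ 0)) ≡⟨ sym (sumR-+ N _ _) ⟩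
    sumR N (λ a → chordDeg N p a * chordDeg N p a + 3 * ind (a ≡ᵇ 0)) ≡⟨ sumR-cong N chordDeg-square ⟩
    sumR N (λ a → 4 + 5 * ind (a ≡ᵇ p)) ≡⟨ sumR-+ N _ _ ⟩
    sumR N (λ _ → 4) + sumR N (λ a → 5 * ind (a ≡ᵇ p)) ≡⟨ cong₂ _+_ (trans (sumR-const N 4) (*-comm N 4)) (trans (sumR-*ˡ N 5 _) (cong (5 *_) count-p)) ⟩
    4 * N + 5 ≡⟨ ar N ⟩
    4 * N + 2 + 3 ∎)
    where
    open ≡-Reasoning
    ar : ∀ N → 4 * N + 5 ≡ 4 * N + 2 + 3
    ar = solve-∀

module LabelledDegrees {N : ℕ} (G : Graph N) (p : ℕ) (L : Labelling G p) where
  open Labelling L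
  open DegreeSums G
  open ChordDegrees N p p≥1 p+3

  degg : ∀ i → deg (g i) ≡ chordDeg N p (toℕ i)
  degg i = begin
    S N (λ v → ind (adj G (g i) v)) ≡⟨ perm-S N g gi g-gi gi-g _ ⟩
    S N (λ j → ind (adj G (g i) (g j))) ≡⟨ S-cong N (λ j → cong ind (adjg i j)) ⟩
    S N (λ j → ind (chordAdj N p (toℕ i) (toℕ j))) ≡⟨ S-toℕ N _ ⟩
    sumR N (λ k → ind (chordAdj N p (toℕ i) k)) ≡⟨ chordAdj-degree (toℕ i) (FP.toℕ<n i) ⟩
    chordDeg N p (toℕ i) ∎
    where open ≡-Reasoning

  sdeg-lab : sdeg ≡ 2 * N
  sdeg-lab = trans (perm-S N g gi g-gi gi-g deg) (trans (S-cong N degg) (trans (S-toℕ N (chordDeg N p)) chordDeg-sum))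

  sdeg2-lab : sdeg2 ≡ 4 * N + 2
  sdeg2-lab = trans (perm-S N g gi g-gi gi-g _) (trans (S-cong N (λ i → cong₂ _*_ (degg i) (degg i)))
    (trans (S-toℕ N (λ a → chordDeg N p a * chordDeg N p a)) chordDeg-square-sum))

-- Connectivity of a path with chord: the whole graph is connected, and
-- deleting vertex κ leaves it connected iff κ = 0 or κ > p (deleting a
-- vertex of the path part or the attachment p disconnects the end 0 from
-- the vertex N-1).  So exactly N - p vertex-deleted subgraphs are
-- connected, i.e.  Qcoeff G (N-1) 1 = N - p.
module LabelledConnectivity {N : ℕ} (G : Graph N) (p : ℕ) (L : Labelling G p) where
  open Labelling L

  gn : (k : ℕ) → k < N → Fin N
  gn k lt = g (fromℕ< lt)

  gn-cong : ∀ {k k'} (lt : k < N) (lt' : k' < N) → k ≡ k' → gn k lt ≡ gn k' lt'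
  gn-cong lt lt' refl = refl

  idx : Fin N → ℕ
  idx v = toℕ (gi v)

  idx<N : ∀ v → idx v < N
  idx<N v = FP.toℕ<n (gi v)

  gn-idx : ∀ v → gn (idx v) (idx<N v) ≡ v
  gn-idx v = trans (cong g (FP.fromℕ<-toℕ (gi v) (idx<N v))) (g-gi v)

  idx-gn : ∀ k (lt : k < N) → idx (gn k lt) ≡ k
  idx-gn k lt = trans (cong toℕ (gi-g (fromℕ< lt))) (FP.toℕ-fromℕ< lt)

  adjgn : ∀ a b (la : a < N) (lb : b < N) → adj G (gn a la) (gn b lb) ≡ chordAdj N p a b
  adjgn a b la lb = trans (adjg (fromℕ< la) (fromℕ< lb)) (cong₂ (chordAdj N p) (FP.toℕ-fromℕ< la) (FP.toℕ-fromℕ< lb))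

  gn-inj : ∀ a b (la : a < N) (lb : b < N) → gn a la ≡ gn b lb → a ≡ b
  gn-inj a b la lb e = trans (sym (idx-gn a la)) (trans (cong idx e) (idx-gn b lb))

  N≥1 : 1 ≤ N
  N≥1 = ≤-trans (s≤s z≤n) (≤-trans (m≤n+m 3 p) p+3)

  p<N : p < N
  p<N = ≤-trans (≤-trans (≤-reflexive (+-comm 1 p)) (+-monoʳ-≤ p (s≤s z≤n))) p+3

  N1<N : N ∸ 1 < N
  N1<N = lt-pred N N≥1

  chain : ∀ (X : Subset N) lo hi → (lo<N : lo < N) →
    (∀ k (lt : k < N) → lo ≤ k → k ≤ hi → lookup X (gn k lt) ≡ true) →
    ∀ k (lt : k < N) → lo ≤ k → k ≤ hi → connected G X (gn lo lo<N) (gn k lt) ≡ true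
  chain X lo hi lo<N memX zero lt le kh with n≤0⇒n≡0 le
  ... | refl = conn-refl G X _ (memX 0 lt z≤n kh)
  chain X lo hi lo<N memX (suc k) lt le kh with lo ≟ suc k
  ... | yes refl = conn-refl G X _ (memX (suc k) lt le kh)
  ... | no ne = conn-trans G X _ _ _ (chain X lo hi lo<N memX k klt lo≤k (≤-trans (n≤1+n k) kh))
                  (conn-adj G X _ _ (memX k klt lo≤k (≤-trans (n≤1+n k) kh)) (memX (suc k) lt le kh)
                    (trans (adjgn k (suc k) klt lt) (chordAdj-i1 N p k (suc k) refl)))
    where
    klt : k < N
    klt = <-trans (n<1+n k) lt
    lo≤k : lo ≤ k
    lo≤k = s≤s⁻¹ (≤∧≢⇒< le ne)

  ≤N-1 : ∀ j → j < N → j ≤ N ∸ 1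
  ≤N-1 j lt = ≤-pred (subst (j <_) (sym (trans (+-comm 1 (N ∸ 1)) (m∸n+n≡m N≥1))) lt)

  -- the whole graph is connected: every vertex is joined to 0 along the path
  comp-full : components G (full N) ≡ 1
  comp-full = one-component G (full N) g0 (mem-full g0) (conn-star G (full N) g0 c0)
    where
    g0 : Fin N
    g0 = gn 0 N≥1
    c0 : ∀ v → lookup (full N) v ≡ true → connected G (full N) g0 v ≡ true
    c0 v _ = subst (λ z → connected G (full N) g0 z ≡ true) (gn-idx v)
      (chain (full N) 0 (N ∸ 1) N≥1 (λ k lt _ _ → mem-full (gn k lt)) (idx v) (idx<N v) z≤n (≤N-1 _ (idx<N v)))

  module Deletion (κ : ℕ) (lκ : κ < N) where
    X : Subset N
    X = co1 (gn κ lκ)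

    memX : ∀ v → lookup X v ≡ not (eqF (gn κ lκ) v)
    memX v = lookup∘tabulate (λ v → not (eqF (gn κ lκ) v)) v

    inX : ∀ j (lj : j < N) → ¬ j ≡ κ → lookup X (gn j lj) ≡ true
    inX j lj ne = trans (memX _) (not-false (eqF-false (λ e → ne (sym (gn-inj κ j lκ lj e)))))

    idxX : ∀ v → lookup X v ≡ true → ¬ idx v ≡ κ
    idxX v h e = t≢f (trans (sym (memX v)) h) (cong not (eqF-intro (trans (gn-cong lκ (idx<N v) (sym e)) (gn-idx v))))

    -- deleting the end 0 leaves the path 1, …, N-1 (with its chord)
    delete-end : κ ≡ 0 → components G X ≡ 1
    delete-end refl = one-component G X g1 (inX 1 1<N (λ ())) (conn-star G X g1 c1)
      where
      1<N : 1 < N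
      1<N = ≤-trans (s≤s (s≤s z≤n)) (≤-trans (m≤n+m 3 p) p+3)
      g1 : Fin N
      g1 = gn 1 1<N
      c1 : ∀ v → lookup X v ≡ true → connected G X g1 v ≡ true
      c1 v hv = subst (λ z → connected G X g1 z ≡ true) (gn-idx v)
        (chain X 1 (N ∸ 1) 1<N (λ k lt le _ → inX k lt (λ e → <-irrefl (sym e) le)) (idx v) (idx<N v)
          (1≤-≢0 (idxX v hv)) (≤N-1 _ (idx<N v)))

    -- deleting a cycle vertex other than p: the labels below κ form a path
    -- from 0 to p, and the chord p — (N-1) reaches the labels above κ
    delete-cycle : p < κ → components G X ≡ 1
    delete-cycle pκ = one-component G X g0 (inX 0 0<N (λ e → <-irrefl e (≤-trans (s≤s z≤n) pκ))) (conn-star G X g0 c0)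
      where
      0<N : 0 < N
      0<N = N≥1
      g0 : Fin N
      g0 = gn 0 0<N
      c-low : ∀ j (lj : j < N) → j < κ → connected G X g0 (gn j lj) ≡ true
      c-low j lj jκ = chain X 0 (κ ∸ 1) 0<N (λ k lt _ kh → inX k lt (λ e → <-irrefl e (≤-trans (s≤s kh) (≤-reflexive (trans (+-comm 1 (κ ∸ 1)) (m∸n+n≡m (≤-trans (s≤s z≤n) pκ))))))) j lj z≤n
        (≤-pred (≤-trans jκ (≤-reflexive (sym (trans (+-comm 1 (κ ∸ 1)) (m∸n+n≡m (≤-trans (s≤s z≤n) pκ)))))))
      c-high : ∀ j (lj : j < N) → κ < j → connected G X g0 (gn j lj) ≡ true
      c-high j lj κj = conn-trans G X _ _ _ (c-low p p<N pκ)
         (conn-trans G X _ _ _ (conn-adj G X _ _ (inX p p<N (λ e → <-irrefl e pκ)) (inX (N ∸ 1) N1<N (λ e → <-irrefl (sym e) (≤-trans κj (≤N-1 j lj))))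
              (trans (adjgn p (N ∸ 1) p<N N1<N) (chordAdj-i3 N p p (N ∸ 1) refl refl)))
           (conn-trans G X _ _ _ (conn-sym G X _ _ (ch (N ∸ 1) N1<N (≤-trans κj (≤N-1 j lj)) ≤-refl)) (ch j lj κj (≤N-1 j lj))))
        where
        κ1<N : suc κ < N
        κ1<N = ≤-trans (s≤s κj) lj
        ch : ∀ k (lk : k < N) → suc κ ≤ k → k ≤ N ∸ 1 → connected G X (gn (suc κ) κ1<N) (gn k lk) ≡ true
        ch = chain X (suc κ) (N ∸ 1) κ1<N (λ k lt le _ → inX k lt (λ e → <-irrefl (sym e) le))
      c0 : ∀ v → lookup X v ≡ true → connected G X g0 v ≡ true
      c0 v hv with <-cmp (idx v) κ
      ... | tri< lt _ _ = subst (λ z → connected G X g0 z ≡ true) (gn-idx v) (c-low (idx v) (idx<N v) lt)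
      ... | tri≈ _ e _ = ⊥-elim (idxX v hv e)
      ... | tri> _ _ gt = subst (λ z → connected G X g0 z ≡ true) (gn-idx v) (c-high (idx v) (idx<N v) gt)

    -- deleting 1 ≤ κ ≤ p separates the labels below κ from those above
    delete-separating : 1 ≤ κ → κ ≤ p → 2 ≤ components G X
    delete-separating κ≥1 κ≤p = two-components G X Sb (gn 0 N≥1) (gn (N ∸ 1) N1<N)
      (inX 0 N≥1 (λ e → <-irrefl e κ≥1)) (inX (N ∸ 1) N1<N (λ e → <-irrefl (sym e) (≤-<-trans κ≤p N-1>p)))
      (trans (cong (λ z → z <ᵇ κ) (idx-gn 0 N≥1)) (ltb-intro κ≥1))
      (trans (cong (λ z → z <ᵇ κ) (idx-gn (N ∸ 1) N1<N)) (ltb-false (N ∸ 1) κ (λ h → <-asym h (≤-<-trans κ≤p N-1>p))))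
      closed
      where
      N-1>p : p < N ∸ 1
      N-1>p = ≤-trans (≤-reflexive (+-comm 1 p)) (≤-trans (+-monoʳ-≤ p (s≤s (z≤n {1}))) (≤-trans (≤-reflexive (sym (+-∸-assoc p {3} {1} (s≤s z≤n)))) (∸-monoˡ-≤ 1 p+3)))
      Sb : Fin N → Bool
      Sb v = idx v <ᵇ κ
      -- no edge avoiding κ crosses κ
      no-crossing : ∀ a b → ¬ a ≡ κ → ¬ b ≡ κ → chordAdj N p a b ≡ true → (a <ᵇ κ) ≡ (b <ᵇ κ)
      no-crossing a b na nb t with chordAdj-elim N p a b t
      ... | inj₁ refl = boolEq (λ h → ltb-intro (≤∧≢⇒< (ltb-true a κ h) nb)) (λ h → ltb-intro (<-trans (n<1+n a) (ltb-true (suc a) κ h)))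
      ... | inj₂ (inj₁ refl) = boolEq (λ h → ltb-intro (<-trans (n<1+n b) (ltb-true (suc b) κ h))) (λ h → ltb-intro (≤∧≢⇒< (ltb-true b κ h) na))
      ... | inj₂ (inj₂ (inj₁ (refl , refl))) = trans (ltb-false p κ (λ h → <-asym h (≤∧≢⇒< κ≤p (λ e → na (sym e)))))
                                                  (sym (ltb-false (N ∸ 1) κ (λ h → <-asym h (≤-<-trans κ≤p N-1>p))))
      ... | inj₂ (inj₂ (inj₂ (refl , refl))) = trans (ltb-false (N ∸ 1) κ (λ h → <-asym h (≤-<-trans κ≤p N-1>p)))
                                                  (sym (ltb-false p κ (λ h → <-asym h (≤∧≢⇒< κ≤p (λ e → nb (sym e))))))
      closed : ∀ x y → lookup X x ≡ true → lookup X y ≡ true → adj G x y ≡ true → Sb x ≡ Sb y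
      closed x y hx hy a = no-crossing (idx x) (idx y) (idxX x hx) (idxX y hy)
        (trans (sym (adjgn (idx x) (idx y) (idx<N x) (idx<N y))) (trans (cong₂ (adj G) (gn-idx x) (gn-idx y)) a))

    deletion-connected : (components G X ≡ᵇ 1) ≡ ((κ ≡ᵇ 0) ∨ (p <ᵇ κ))
    deletion-connected with κ ≟ 0 | p <? κ
    ... | yes e | _ = trans (cong (_≡ᵇ 1) (delete-end e)) (sym (cong (_∨ (p <ᵇ κ)) (eqb-intro e)))
    ... | no ne | yes pκ = trans (cong (_≡ᵇ 1) (delete-cycle pκ)) (sym (∨-introʳ (κ ≡ᵇ 0) (ltb-intro pκ)))
    ... | no ne | no npκ = trans (≡ᵇ-1 _ (delete-separating (1≤-≢0 ne) (≮⇒≥ npκ))) (sym (∨-false (eqb-false κ 0 ne) (ltb-false p κ npκ)))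

suc-∸ : ∀ m n → n < m → m ∸ n ≡ suc (m ∸ suc n)
suc-∸ (suc m) zero _ = refl
suc-∸ (suc m) (suc n) (s≤s lt) = suc-∸ m n lt

sumR-gt : ∀ N p → sumR N (λ k → ind (p <ᵇ k)) ≡ N ∸ suc p
sumR-gt zero p = refl
sumR-gt (suc N) p with p <? N
... | yes lt = trans (cong₂ _+_ (sumR-gt N p) (cong ind (ltb-intro lt))) (trans (+-comm _ 1) (sym (suc-∸ N p lt)))
... | no nlt = trans (cong₂ _+_ (sumR-gt N p) (cong ind (ltb-false p N nlt)))
                 (trans (+-identityʳ _) (trans (m≤n⇒m∸n≡0 (≤-trans (≮⇒≥ nlt) (n≤1+n p))) (sym (m≤n⇒m∸n≡0 (≮⇒≥ nlt)))))

deletion-count : ∀ N' (G : Graph (suc N')) p → Labelling G p → Qcoeff G N' 1 ≡ suc N' ∸ p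
deletion-count N' G p L = begin
  Qcoeff G N' 1 ≡⟨ cntN-1 N' (λ X → components G X ≡ᵇ 1) ⟩
  S N (λ a → ind (components G (co1 a) ≡ᵇ 1)) ≡⟨ perm-S N g gi g-gi gi-g (λ a → ind (components G (co1 a) ≡ᵇ 1)) ⟩
  S N (λ i → ind (components G (co1 (g i)) ≡ᵇ 1)) ≡⟨ S-cong N pt ⟩
  S N (λ i → hval (toℕ i)) ≡⟨ S-toℕ N hval ⟩
  sumR N hval ≡⟨ sumR-cong N (λ k _ → split k) ⟩
  sumR N (λ k → ind (k ≡ᵇ 0) + ind (p <ᵇ k)) ≡⟨ sumR-+ N _ _ ⟩
  sumR N (λ k → ind (k ≡ᵇ 0)) + sumR N (λ k → ind (p <ᵇ k)) ≡⟨ cong₂ _+_ (trans (sumR-eq N 0) refl) (sumR-gt N p) ⟩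
  1 + (N ∸ suc p) ≡⟨ sym (suc-∸ N p p<N) ⟩
  N ∸ p ∎
  where
  open ≡-Reasoning
  open Labelling L
  open LabelledConnectivity G p L
  N : ℕ
  N = suc N'
  hval : ℕ → ℕ
  hval k = ind ((k ≡ᵇ 0) ∨ (p <ᵇ k))
  pt : ∀ i → ind (components G (co1 (g i)) ≡ᵇ 1) ≡ hval (toℕ i)
  pt i = trans (cong (λ z → ind (components G (co1 (g z)) ≡ᵇ 1)) (sym (FP.fromℕ<-toℕ i (FP.toℕ<n i))))
           (cong ind (Deletion.deletion-connected (toℕ i) (FP.toℕ<n i)))
  split : ∀ k → hval k ≡ ind (k ≡ᵇ 0) + ind (p <ᵇ k)
  split zero = refl
  split (suc k) = refl


first : ∀ {n} → (Fin n → Bool) → Maybe (Fin n)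
first {zero} P = nothing
first {suc n} P with P zero
... | true = just zero
... | false with first {n} (P ∘ suc)
... | just j = just (suc j)
... | nothing = nothing

first-spec : ∀ {n} (P : Fin n → Bool) i → P i ≡ true → Σ (Fin n) λ j → first P ≡ just j × P j ≡ true
first-spec {suc n} P i h with P zero in e0
... | true = zero , refl , e0
... | false with i
... | zero = ⊥-elim (t≢f h e0)
... | suc i' with first {n} (P ∘ suc) | first-spec (P ∘ suc) i' h
... | just j | .j , refl , hj = suc j , refl , hj

anyℕ : ℕ → (ℕ → Bool) → Bool
anyℕ zero q = false
anyℕ (suc j) q = anyℕ j q ∨ q j

anyℕ-true : ∀ j q → anyℕ j q ≡ true → Σ ℕ λ i → i < j × q i ≡ true
anyℕ-true (suc j) q h with ∨-true (anyℕ j q) (q j) h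
... | inj₁ h' with anyℕ-true j q h'
... | i , lt , qi = i , m≤n⇒m≤1+n lt , qi
anyℕ-true (suc j) q h | inj₂ h' = j , n<1+n j , h'

anyℕ-intro : ∀ j q i → i < j → q i ≡ true → anyℕ j q ≡ true
anyℕ-intro (suc j) q i lt h with i ≟ j
... | yes refl = ∨-introʳ (anyℕ i q) h
... | no ne = ∨-introˡ (q j) (anyℕ-intro j q i (≤∧≢⇒< (≤-pred lt) ne) h)

leastℕ : ∀ (P : ℕ → Bool) j₀ → P j₀ ≡ true → Σ ℕ λ j → P j ≡ true × j ≤ j₀ × (∀ j' → j' < j → P j' ≡ false)
leastℕ P j₀ h with least {suc j₀} (P ∘ toℕ) (F.fromℕ j₀) (subst (λ z → P z ≡ true) (sym (FP.toℕ-fromℕ j₀)) h)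
... | a , pa , la = toℕ a , pa , ≤-pred (FP.toℕ<n a) , λ j' lt →
  subst (λ z → P z ≡ false) (FP.toℕ-fromℕ< (<-trans lt (FP.toℕ<n a)))
    (la (fromℕ< (<-trans lt (FP.toℕ<n a))) (subst (_< toℕ a) (sym (FP.toℕ-fromℕ< (<-trans lt (FP.toℕ<n a)))) lt))

-- Let H be connected (stated as: every edge-closed predicate true at ℓ is
-- true everywhere), with deg ℓ = 1, deg w = 3 and all other degrees 2.
-- Walk from the leaf ℓ, always leaving a vertex by an edge other than the
-- one just used: s 0 = ℓ, s 1 = its neighbour, s (i+2) = a neighbour of
-- s (i+1) other than s i.  Let s (K+1) be the first repeated vertex, equal to
-- s j*.  Then s j* has three neighbours s (j*-1), s (j*+1), s K, so it is w;
-- every other s i (0 < i ≤ K) has exactly the neighbours s (i±1); the set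
-- {s 0, …, s K} is closed under adjacency, hence everything; and i ↦ s i is
-- a labelling of H as the path with chord j*.
module LeafWalk {N : ℕ} (H : Graph N) (ℓ w : Fin N) (ℓ≢w : ¬ ℓ ≡ w)
  (dℓ : DegreeSums.deg H ℓ ≡ 1) (dw : DegreeSums.deg H w ≡ 3)
  (d2 : ∀ v → ¬ v ≡ ℓ → ¬ v ≡ w → DegreeSums.deg H v ≡ 2)
  (conn : ∀ (Sb : Fin N → Bool) → Sb ℓ ≡ true → (∀ x y → adj H x y ≡ true → Sb x ≡ true → Sb y ≡ true) → ∀ v → Sb v ≡ true) where

  open DegreeSums H using (deg)

  A : Fin N → Fin N → Bool
  A = adj H

  Asym : ∀ {x y} → A x y ≡ true → A y x ≡ true
  Asym {x} {y} h = trans (Graph.sym H y x) h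

  -- nb x y: a neighbour of x other than y (whenever one exists)
  nb : Fin N → Fin N → Fin N
  nb x y = fromMaybe x (first (λ u → A x u ∧ not (eqF y u)))

  nb-spec : ∀ x y u → (A x u ∧ not (eqF y u)) ≡ true → A x (nb x y) ≡ true × ¬ nb x y ≡ y
  nb-spec x y u h with first (λ u → A x u ∧ not (eqF y u)) | first-spec (λ u → A x u ∧ not (eqF y u)) u h
  ... | just j | .j , refl , hj = proj₁ (∧-true _ _ hj) , λ e → t≢f (proj₂ (∧-true _ _ hj)) (cong not (eqF-intro (sym e)))

  other : ∀ x y → 2 ≤ deg x → Σ (Fin N) λ u → (A x u ∧ not (eqF y u)) ≡ true
  other x y d with FP.any? (λ u → (A x u ∧ not (eqF y u)) B.≟ true)
  ... | yes r = r
  ... | no nr = ⊥-elim (<⇒≱ d (≤-trans (S-mono N pt) (≤-reflexive (S-single N y))))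
    where
    pt : ∀ u → ind (A x u) ≤ ind (eqF y u)
    pt u with A x u in eu | eqF y u in ey
    ... | false | _ = z≤n
    ... | true | true = ≤-refl
    ... | true | false = ⊥-elim (nr (u , trans (cong₂ (λ a b → a ∧ not b) eu ey) refl))

  sat : ∀ x (K : Fin N → Bool) → (∀ u → K u ≡ true → A x u ≡ true) → S N (λ u → ind (K u)) ≡ deg x →
    ∀ v → A x v ≡ true → K v ≡ true
  sat x K hK cnt v av with K v in kv
  ... | true = refl
  ... | false = ⊥-elim (<-irrefl cnt (S-strict N pt v lt))
    where
    pt : ∀ u → ind (K u) ≤ ind (A x u)
    pt u with K u in ku
    ... | false = z≤n
    ... | true = ≤-reflexive (cong ind (sym (hK u ku)))
    lt : ind (K v) < ind (A x v)
    lt rewrite kv | av = s≤s z≤n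

  K2 : Fin N → Fin N → Fin N → Bool
  K2 a b u = eqF a u ∨ eqF b u
  K3 : Fin N → Fin N → Fin N → Fin N → Bool
  K3 a b c u = eqF a u ∨ eqF b u ∨ eqF c u

  three-lb : ∀ x a b c → ¬ a ≡ b → ¬ a ≡ c → ¬ b ≡ c → A x a ≡ true → A x b ≡ true → A x c ≡ true → 3 ≤ deg x
  three-lb x a b c ab ac bc ha hb hc = subst (_≤ deg x) (S-triple N a b c ab ac bc) (S-mono N pt)
    where
    pt : ∀ u → ind (K3 a b c u) ≤ ind (A x u)
    pt u with a FP.≟ u | b FP.≟ u | c FP.≟ u
    ... | yes refl | _ | _ rewrite ha = ≤-refl
    ... | no _ | yes refl | _ rewrite hb = ≤-refl
    ... | no _ | no _ | yes refl rewrite hc = ≤-refl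
    ... | no _ | no _ | no _ = z≤n

  s : ℕ → Fin N
  s zero = ℓ
  s (suc zero) = nb ℓ ℓ
  s (suc (suc k)) = nb (s (suc k)) (s k)

  D : ℕ → Bool
  D j = anyℕ j (λ i → eqF (s i) (s j))

  N≥1 : 1 ≤ N
  N≥1 = ≤-trans (s≤s z≤n) (FP.toℕ<n ℓ)

  rep : Σ ℕ λ j → D j ≡ true × j ≤ N
  rep with FP.pigeonhole (n<1+n N) (λ (i : Fin (suc N)) → s (toℕ i))
  ... | i , j , lt , e = toℕ j , anyℕ-intro (toℕ j) _ (toℕ i) lt (eqF-intro e) , ≤-pred (FP.toℕ<n j)

  Jmin : Σ ℕ λ j → D j ≡ true × j ≤ proj₁ rep × (∀ j' → j' < j → D j' ≡ false)
  Jmin = leastℕ D (proj₁ rep) (proj₁ (proj₂ rep))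
  Jx : ℕ
  Jx = proj₁ Jmin
  DJ : D Jx ≡ true
  DJ = proj₁ (proj₂ Jmin)
  Jmin' : ∀ j' → j' < Jx → D j' ≡ false
  Jmin' = proj₂ (proj₂ (proj₂ Jmin))

  K₀ : ℕ
  K₀ = Jx ∸ 1

  Jx≡ : Jx ≡ suc K₀
  Jx≡ with Jx | DJ
  ... | zero | ()
  ... | suc k | _ = refl

  Inj₀ : ∀ i j → i ≤ K₀ → j ≤ K₀ → s i ≡ s j → i ≡ j
  Inj₀ i j hi hj e with <-cmp i j
  ... | tri≈ _ eq _ = eq
  ... | tri< lt _ _ = ⊥-elim (t≢f (anyℕ-intro j _ i lt (eqF-intro e)) (Jmin' j (subst (j <_) (sym Jx≡) (s≤s hj))))
  ... | tri> _ _ gt = ⊥-elim (t≢f (anyℕ-intro i _ j gt (eqF-intro (sym e))) (Jmin' i (subst (i <_) (sym Jx≡) (s≤s hi))))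

  jstar : Σ ℕ λ j → j < suc K₀ × eqF (s j) (s (suc K₀)) ≡ true
  jstar = anyℕ-true (suc K₀) (λ i → eqF (s i) (s (suc K₀))) (subst (λ z → D z ≡ true) Jx≡ DJ)
  j₀ : ℕ
  j₀ = proj₁ jstar
  j₀<  : j₀ < suc K₀
  j₀< = proj₁ (proj₂ jstar)
  sK₀ : s (suc K₀) ≡ s j₀
  sK₀ = sym (eqF-true (proj₂ (proj₂ jstar)))
  j₀≤K₀ : j₀ ≤ K₀
  j₀≤K₀ = ≤-pred j₀<

  module FirstReturn (K : ℕ) (j* : ℕ) (Inj : ∀ i j → i ≤ K → j ≤ K → s i ≡ s j → i ≡ j) (j*≤K : j* ≤ K) (sK1 : s (suc K) ≡ s j*) where

    ℓnb : Σ (Fin N) λ u → (A ℓ u ∧ not (eqF ℓ u)) ≡ true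
    ℓnb with FP.any? (λ u → A ℓ u B.≟ true)
    ... | yes (u , h) = u , ∧-intro h (not-false (eqF-false (λ e → t≢f h (subst (λ z → A ℓ z ≡ false) e (irrefl H ℓ)))))
    ... | no nr = ⊥-elim (<-irrefl (trans (sym (S-zero N)) (trans (S-cong N pt) dℓ)) (s≤s z≤n))
      where
      pt : ∀ u → 0 ≡ ind (A ℓ u)
      pt u with A ℓ u in eu
      ... | true = ⊥-elim (nr (u , eu))
      ... | false = refl

    s1adj : A ℓ (s 1) ≡ true
    s1adj = proj₁ (nb-spec ℓ ℓ (proj₁ ℓnb) (proj₂ ℓnb))

    -- the walk does not return to the leaf, so its inner vertices have degree ≥ 2
    notℓ : ∀ i → 1 ≤ i → i ≤ K → ¬ s i ≡ ℓ
    notℓ i h1 hK e with Inj i 0 hK z≤n e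
    notℓ (suc i) h1 hK e | ()

    deg≥2 : ∀ i → 1 ≤ i → i ≤ K → 2 ≤ deg (s i)
    deg≥2 i h1 hK with s i FP.≟ w
    ... | yes e = subst (λ z → 2 ≤ deg z) (sym e) (≤-reflexive' dw)
      where
      ≤-reflexive' : ∀ {x} → x ≡ 3 → 2 ≤ x
      ≤-reflexive' refl = s≤s (s≤s z≤n)
    ... | no ne = ≤-reflexive (sym (d2 (s i) (notℓ i h1 hK) ne))

    step : ∀ i → suc i ≤ K → A (s (suc i)) (s (suc (suc i))) ≡ true × ¬ s (suc (suc i)) ≡ s i
    step i h = let (u , hu) = other (s (suc i)) (s i) (deg≥2 (suc i) (s≤s z≤n) h) in nb-spec (s (suc i)) (s i) u hu

    adjS : ∀ i → i ≤ K → A (s i) (s (suc i)) ≡ true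
    adjS zero _ = s1adj
    adjS (suc i) h = proj₁ (step i h)

    K≥1 : 1 ≤ K
    K≥1 with K ≟ 0
    ... | yes e = ⊥-elim (t≢f (subst (λ z → A ℓ z ≡ true) s1≡ℓ (adjS 0 z≤n)) (irrefl H ℓ))
      where
      j*≡0 : j* ≡ 0
      j*≡0 = n≤0⇒n≡0 (subst (j* ≤_) e j*≤K)
      s1≡ℓ : s 1 ≡ ℓ
      s1≡ℓ = trans (cong (s ∘ suc) (sym e)) (trans sK1 (cong s j*≡0))
    ... | no ne = 1≤-≢0 ne

    j*≢K : ¬ j* ≡ K
    j*≢K e = t≢f (subst (λ z → A (s K) z ≡ true) (trans sK1 (cong s e)) (adjS K ≤-refl)) (irrefl H (s K))

    j*≢K-1 : ¬ suc j* ≡ K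
    j*≢K-1 e = proj₂ (step j* (≤-reflexive e)) (subst (λ z → s (suc z) ≡ s j*) (sym e) sK1)

    ℓ-only : ∀ v → A ℓ v ≡ true → v ≡ s 1
    ℓ-only v h = sym (eqF-true (sat ℓ (eqF (s 1)) (λ u e → subst (λ z → A ℓ z ≡ true) (eqF-true e) s1adj)
                                 (trans (S-single N (s 1)) (sym dℓ)) v h))

    j*≢0 : ¬ j* ≡ 0
    j*≢0 e = proj₂ (step 0 K1) (trans (cong (s ∘ suc) (sym K≡1)) (trans sK1 (cong s e)))
      where
      sK≡s1 : s K ≡ s 1
      sK≡s1 = ℓ-only (s K) (Asym (subst (λ z → A (s K) z ≡ true) (trans sK1 (cong s e)) (adjS K ≤-refl)))
      K≡1 : K ≡ 1
      K≡1 = Inj K 1 ≤-refl K≥1 sK≡s1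
      K1 : 1 ≤ K
      K1 = K≥1

    j*≥1 : 1 ≤ j*
    j*≥1 = 1≤-≢0 j*≢0

    j*+2≤K : suc (suc j*) ≤ K
    j*+2≤K = ≤∧≢⇒< (≤∧≢⇒< j*≤K j*≢K) j*≢K-1

    jm : ℕ
    jm = j* ∸ 1
    sjm : suc jm ≡ j*
    sjm = trans (+-comm 1 jm) (m∸n+n≡m j*≥1)

    jm≤K : jm ≤ K
    jm≤K = ≤-trans (m∸n≤m j* 1) j*≤K

    d12 : ¬ s jm ≡ s (suc j*)
    d12 e = <-irrefl (Inj jm (suc j*) jm≤K (≤-trans (n≤1+n _) j*+2≤K) e) (s≤s (m∸n≤m j* 1))
    d13 : ¬ s jm ≡ s K
    d13 e = <-irrefl (Inj jm K jm≤K ≤-refl e) (≤-trans (s≤s (m∸n≤m j* 1)) (≤-trans (n≤1+n _) j*+2≤K))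
    d23 : ¬ s (suc j*) ≡ s K
    d23 e = <-irrefl (Inj (suc j*) K (≤-trans (n≤1+n _) j*+2≤K) ≤-refl e) j*+2≤K
    a1 : A (s j*) (s jm) ≡ true
    a1 = Asym (subst (λ z → A (s jm) (s z) ≡ true) sjm (adjS jm jm≤K))
    a2 : A (s j*) (s (suc j*)) ≡ true
    a2 = adjS j* j*≤K
    a3 : A (s j*) (s K) ≡ true
    a3 = Asym (subst (λ z → A (s K) z ≡ true) sK1 (adjS K ≤-refl))

    -- the vertex hit again has three neighbours, so it is w
    sj*=w : s j* ≡ w
    sj*=w with s j* FP.≟ w
    ... | yes e = e
    ... | no ne = ⊥-elim (<-irrefl (sym (d2 (s j*) (notℓ j* j*≥1 j*≤K) ne))
                            (≤-trans (s≤s (s≤s (s≤s z≤n))) (three-lb (s j*) _ _ _ d12 d13 d23 a1 a2 a3)))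

    w-nbrs : ∀ y → A (s j*) y ≡ true → y ≡ s jm ⊎ y ≡ s (suc j*) ⊎ y ≡ s K
    w-nbrs y h = in3 (s jm) (s (suc j*)) (s K) y (sat (s j*) (K3 (s jm) (s (suc j*)) (s K)) hK
      (trans (S-triple N (s jm) (s (suc j*)) (s K) d12 d13 d23) (sym (trans (cong deg sj*=w) dw))) y h)
      where
      hK : ∀ u → K3 (s jm) (s (suc j*)) (s K) u ≡ true → A (s j*) u ≡ true
      hK u e with in3 (s jm) (s (suc j*)) (s K) u e
      ... | inj₁ refl = a1
      ... | inj₂ (inj₁ refl) = a2
      ... | inj₂ (inj₂ refl) = a3

    mid-nbrs : ∀ i → suc i ≤ K → ¬ suc i ≡ j* → ∀ y → A (s (suc i)) y ≡ true → y ≡ s i ⊎ y ≡ s (suc (suc i))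
    mid-nbrs i h ne y ay = in2 (s i) (s (suc (suc i))) y (sat (s (suc i)) (K2 (s i) (s (suc (suc i)))) hK
      (trans (S-pair N (s i) (s (suc (suc i))) (λ e → proj₂ (step i h) (sym e))) (sym dg)) y ay)
      where
      dg : deg (s (suc i)) ≡ 2
      dg = d2 _ (notℓ (suc i) (s≤s z≤n) h) (λ e → ne (Inj (suc i) j* h j*≤K (trans e (sym sj*=w))))
      hK : ∀ u → K2 (s i) (s (suc (suc i))) u ≡ true → A (s (suc i)) u ≡ true
      hK u e with in2 (s i) (s (suc (suc i))) u e
      ... | inj₁ refl = Asym (adjS i (≤-trans (n≤1+n i) h))
      ... | inj₂ refl = adjS (suc i) h

    -- the visited set is closed under adjacency, hence everything
    Sset : Fin N → Bool
    Sset v = anyℕ (suc K) (λ i → eqF (s i) v)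

    memS : ∀ i → i ≤ K → Sset (s i) ≡ true
    memS i h = anyℕ-intro (suc K) _ i (s≤s h) (eqF-refl (s i))

    memS' : ∀ i → i ≤ suc K → Sset (s i) ≡ true
    memS' i h with i ≟ suc K
    ... | yes refl = subst (λ z → Sset z ≡ true) (sym sK1) (memS j* j*≤K)
    ... | no ne = memS i (≤-pred (≤∧≢⇒< h ne))

    closed : ∀ x y → A x y ≡ true → Sset x ≡ true → Sset y ≡ true
    closed x y axy sx with anyℕ-true (suc K) _ sx
    ... | i , lt , e with eqF-true {a = s i} {b = x} e
    ... | refl with i
    ... | zero = subst (λ z → Sset z ≡ true) (sym (ℓ-only y axy)) (memS 1 K≥1)
    ... | suc i' with suc i' ≟ j*
    ... | yes q = lem (w-nbrs y (subst (λ z → A (s z) y ≡ true) q axy))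
      where
      lem : y ≡ s jm ⊎ y ≡ s (suc j*) ⊎ y ≡ s K → Sset y ≡ true
      lem (inj₁ refl) = memS jm jm≤K
      lem (inj₂ (inj₁ refl)) = memS (suc j*) (≤-trans (n≤1+n _) j*+2≤K)
      lem (inj₂ (inj₂ refl)) = memS K ≤-refl
    ... | no q with mid-nbrs i' (≤-pred lt) q y axy
    ... | inj₁ refl = memS i' (≤-trans (n≤1+n i') (≤-pred lt))
    ... | inj₂ refl = memS' (suc (suc i')) lt

    cover : ∀ v → Sset v ≡ true
    cover = conn Sset (memS 0 z≤n) closed

    idx : Fin N → ℕ
    idx v = proj₁ (anyℕ-true (suc K) _ (cover v))
    idx< : ∀ v → idx v < suc K
    idx< v = proj₁ (proj₂ (anyℕ-true (suc K) _ (cover v)))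
    sidx : ∀ v → s (idx v) ≡ v
    sidx v = eqF-true (proj₂ (proj₂ (anyℕ-true (suc K) _ (cover v))))

    eqN : suc K ≡ N
    eqN = ≤-antisym (FP.injective⇒≤ {f = λ (i : Fin (suc K)) → s (toℕ i)} inj1) (FP.injective⇒≤ {f = λ v → fromℕ< (idx< v)} inj2)
      where
      inj1 : ∀ {a b : Fin (suc K)} → s (toℕ a) ≡ s (toℕ b) → a ≡ b
      inj1 {a} {b} e = FP.toℕ-injective (Inj (toℕ a) (toℕ b) (≤-pred (FP.toℕ<n a)) (≤-pred (FP.toℕ<n b)) e)
      inj2 : ∀ {a b : Fin N} → fromℕ< (idx< a) ≡ fromℕ< (idx< b) → a ≡ b
      inj2 {a} {b} e = trans (sym (sidx a)) (trans (cong s (trans (sym (FP.toℕ-fromℕ< (idx< a))) (trans (cong toℕ e) (FP.toℕ-fromℕ< (idx< b))))) (sidx b))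

    N-1≡K : N ∸ 1 ≡ K
    N-1≡K = cong (_∸ 1) (sym eqN)

    <N⇒≤K : ∀ a → a < N → a ≤ K
    <N⇒≤K a lt = ≤-pred (subst (a <_) (sym eqN) lt)

    gg : Fin N → Fin N
    gg i = s (toℕ i)

    ggi : Fin N → Fin N
    ggi v = fromℕ< (subst (idx v <_) eqN (idx< v))

    chordAdj⇒adj : ∀ a b → a ≤ K → b ≤ K → chordAdj N j* a b ≡ true → A (s a) (s b) ≡ true
    chordAdj⇒adj a b ha hb t with chordAdj-elim N j* a b t
    ... | inj₁ refl = adjS a ha
    ... | inj₂ (inj₁ refl) = Asym (adjS b hb)
    ... | inj₂ (inj₂ (inj₁ (refl , e))) = subst (λ z → A (s a) (s z) ≡ true) (sym (trans e N-1≡K)) a3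
    ... | inj₂ (inj₂ (inj₂ (refl , e))) = Asym (subst (λ z → A (s b) (s z) ≡ true) (sym (trans e N-1≡K)) a3)

    adj⇒chordAdj : ∀ a b → a ≤ K → b ≤ K → A (s a) (s b) ≡ true → chordAdj N j* a b ≡ true
    adj⇒chordAdj zero b ha hb h = chordAdj-i1 N j* 0 b (Inj b 1 hb K≥1 (ℓ-only (s b) h))
    adj⇒chordAdj (suc a) b ha hb h with suc a ≟ j*
    ... | yes q with w-nbrs (s b) (subst (λ z → A (s z) (s b) ≡ true) q h)
    ... | inj₁ e = chordAdj-i2 N j* (suc a) b (trans q (trans (sym sjm) (cong suc (sym (Inj b jm hb jm≤K e)))))
    ... | inj₂ (inj₁ e) = chordAdj-i1 N j* (suc a) b (trans (Inj b (suc j*) hb (≤-trans (n≤1+n _) j*+2≤K) e) (cong suc (sym q)))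
    ... | inj₂ (inj₂ e) = chordAdj-i3 N j* (suc a) b q (trans (Inj b K hb ≤-refl e) (sym N-1≡K))
    adj⇒chordAdj (suc a) b ha hb h | no ne with mid-nbrs a ha ne (s b) h
    ... | inj₁ e = chordAdj-i2 N j* (suc a) b (cong suc (sym (Inj b a hb (≤-trans (n≤1+n a) ha) e)))
    ... | inj₂ e with suc a ≟ K
    ... | yes q = chordAdj-i4 N j* (suc a) b (Inj b j* hb j*≤K (trans e (trans (cong (s ∘ suc) q) sK1))) (trans q (sym N-1≡K))
    ... | no q = chordAdj-i1 N j* (suc a) b (Inj b (suc (suc a)) hb (≤∧≢⇒< ha q) e)

    lab : Labelling H j*
    lab = record
      { g = gg ; gi = ggi
      ; g-gi = λ v → trans (cong s (FP.toℕ-fromℕ< (subst (idx v <_) eqN (idx< v)))) (sidx v)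
      ; gi-g = λ i → FP.toℕ-injective (trans (FP.toℕ-fromℕ< _)
          (Inj _ _ (≤-pred (idx< (gg i))) (<N⇒≤K _ (FP.toℕ<n i)) (sidx (gg i))))
      ; p≥1 = j*≥1
      ; p+3 = subst (j* + 3 ≤_) eqN (≤-trans (≤-reflexive (+-comm j* 3)) (s≤s j*+2≤K))
      ; adjg = λ i j → boolEq (adj⇒chordAdj _ _ (<N⇒≤K _ (FP.toℕ<n i)) (<N⇒≤K _ (FP.toℕ<n j)))
                              (chordAdj⇒adj _ _ (<N⇒≤K _ (FP.toℕ<n i)) (<N⇒≤K _ (FP.toℕ<n j)))
      }

  labelling : Labelling H j₀
  labelling = FirstReturn.lab K₀ j₀ Inj₀ j₀≤K₀ sK₀


labelled-iso : ∀ {N p} {G G' : Graph N} → Labelling G p → Labelling G' p → G ≅ G'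
labelled-iso {G = G} {G'} L L' = record
  { to = λ v → L'.g (L.gi v)
  ; from = λ v → L.g (L'.gi v)
  ; to∘from = λ v → trans (cong L'.g (L.gi-g (L'.gi v))) (L'.g-gi v)
  ; from∘to = λ u → trans (cong L.g (L'.gi-g (L.gi u))) (L.g-gi u)
  ; adj-pres = λ u v → trans (L'.adjg (L.gi u) (L.gi v))
      (trans (sym (L.adjg (L.gi u) (L.gi v))) (cong₂ (adj G) (L.g-gi u) (L.g-gi v)))
  }
  where
  module L = Labelling L
  module L' = Labelling L'

-- Q detects connectivity: the coefficient of x^N y is [G is connected].
Q-connected : ∀ {N} (G G' : Graph N) → G ≡Q G' → components G' (full N) ≡ 1 → components G (full N) ≡ 1
Q-connected {N} G G' eq conn' =
  eqb-true _ 1 (ind-1 _ (trans (sym (cntN N (λ X → components G X ≡ᵇ 1)))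
    (trans (eq N 1) (trans (cntN N (λ X → components G' X ≡ᵇ 1)) (cong (λ k → ind (k ≡ᵇ 1)) conn')))))

-- In a connected graph, a predicate closed under adjacency and true at one
-- vertex is true everywhere (otherwise it would split the graph).
connected-closure : ∀ {N} (G : Graph N) → components G (full N) ≡ 1 →
  ∀ ℓ (Sb : Fin N → Bool) → Sb ℓ ≡ true → (∀ x y → adj G x y ≡ true → Sb x ≡ true → Sb y ≡ true) →
  ∀ v → Sb v ≡ true
connected-closure {N} G conn ℓ Sb hℓ cl v = ¬false λ Sv →
  <-irrefl (sym conn) (two-components G (full N) Sb ℓ v (mem-full ℓ) (mem-full v) hℓ Sv closed)
  where
  closed : ∀ x y → lookup (full N) x ≡ true → lookup (full N) y ≡ true → adj G x y ≡ true → Sb x ≡ Sb y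
  closed x y _ _ a = boolEq (cl x y a) (cl y x (trans (Graph.sym G y x) a))

-- Q determines the chord position, through the coefficient of x^{N-1} y.
chord-determined : ∀ {N p p'} {G G' : Graph N} → Labelling G p → Labelling G' p' → G ≡Q G' → p ≡ p'
chord-determined {zero} {p} L L' eq with ≤-trans (m≤n+m 3 p) (Labelling.p+3 L)
... | ()
chord-determined {suc N'} {p} {p'} {G} {G'} L L' eq =
  ∸-cancelˡ-≡ (<⇒≤ (LabelledConnectivity.p<N G p L)) (<⇒≤ (LabelledConnectivity.p<N G' p' L'))
    (trans (sym (deletion-count N' G p L)) (trans (eq N' 1) (deletion-count N' G' p' L')))

module TadpoleUnique (m n : ℕ) (m≥1 : 1 ≤ m) (n≥3 : 3 ≤ n) (H : Graph (m + n)) (eq : H ≡Q tadpole m n) where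
  N : ℕ
  N = m + n
  T : Graph N
  T = tadpole m n
  labT : Labelling T m
  labT = tadpole-labelling m n m≥1 n≥3

  sums : (DegreeSums.sdeg H ≡ DegreeSums.sdeg T) × (DegreeSums.sdeg2 H ≡ DegreeSums.sdeg2 T)
  sums = Q-degree-sums H T eq
  degree-sum : DegreeSums.sdeg H ≡ 2 * N
  degree-sum = trans (proj₁ sums) (LabelledDegrees.sdeg-lab T m labT)
  square-sum : DegreeSums.sdeg2 H ≡ 4 * N + 2
  square-sum = trans (proj₂ sums) (LabelledDegrees.sdeg2-lab T m labT)

  profile : DegreeProfile (DegreeSums.deg H)
  profile = degree-profile N (DegreeSums.deg H) degree-sum square-sum
  open DegreeProfile profile

  connectedH : components H (full N) ≡ 1
  connectedH = Q-connected H T eq (LabelledConnectivity.comp-full T m labT)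

  p : ℕ
  p = LeafWalk.j₀ H leaf hub leaf≢hub leaf-deg hub-deg other-deg (connected-closure H connectedH leaf)

  labH : Labelling H p
  labH = LeafWalk.labelling H leaf hub leaf≢hub leaf-deg hub-deg other-deg (connected-closure H connectedH leaf)

  iso : H ≅ T
  iso = labelled-iso (subst (Labelling H) (chord-determined labH labT eq) labH) labT

theorem4p4 : ∀ (m n : ℕ) → 1 ≤ m → 3 ≤ n →
    ∀ {M : ℕ} (H : Graph M) → H ≡Q tadpole m n → H ≅ tadpole m n
theorem4p4 m n m≥1 n≥3 {M} H eq = onOrder sameOrder H eq
  where
  sameOrder : M ≡ m + n
  sameOrder = trans (sym (DegreeSums.Q-order H)) (trans (eq 1 1) (DegreeSums.Q-order (tadpole m n)))
  onOrder : ∀ {M} → M ≡ m + n → (H : Graph M) → H ≡Q tadpole m n → H ≅ tadpole m n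
  onOrder refl H eq = TadpoleUnique.iso m n m≥1 n≥3 H eq
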